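{- Let $N$ denote the number of co-even induced subgraphs of $P_{q}$. Then \begin{equation*} N=\begin{cases} 2^{\frac{q+1}{2}} & \text{if $q\equiv 1\pmod{8}$},\\ 2 & \text{if $q\equiv 5\pmod{8}$}.\end{cases} \end{equation*} In particular, if $q\equiv 5\pmod{8}$, then there exist only trivial co-even induced subgraphs of $P_{q}$, namely the empty graph and $P_{q}$ itself.
   Context: Let $q$ be a prime power with $q\equiv 1\pmod{4}$ and let $\mathbb{F}_{q}$ be the finite field with $q$ elements. The Paley graph $P_{q}$ is the graph on vertex set $\mathbb{F}_{q}$ in which two vertices $x,y$ are adjacent if and only if $x-y$ is a nonzero square in $\mathbb{F}_{q}$. An induced subgraph $H$ of a graph $G$ is called even if every vertex of $H$ has even degree in $H$. A partition $V(G)=V_{1}\sqcup V_{2}$ is an even-even partition if both induced subgraphs $G[V_{1}]$ and $G[V_{2}]$ are even; in that case $G[V_{1}]$ and $G[V_{2}]$ are called a pair of co-even induced subgraphs of $G$. Thus $N$ counts the subsets $V_{1}\subseteq\mathbb{F}_{q}$ (including the empty set and $\mathbb{F}_{q}$ itself) such that both $P_{q}[V_{1}]$ and $P_{q}[\mathbb{F}_{q}\setminus V_{1}]$ are even induced subgraphs. -}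

module Defs where

open import Data.Nat using (ℕ; zero; suc; _^_; _≤_)
open import Data.Nat.Primality using (Prime)
open import Data.Fin using (Fin)
open import Data.Fin.Properties using (any?; all?) renaming (_≟_ to _≟ᶠ_)
open import Data.Fin.Subset using (Subset; _∈_; ∁; inside; outside)
open import Data.Fin.Subset.Properties using (_∈?_)
open import Data.List using (List; []; _∷_; _++_; map; filter; length; allFin)
open import Data.Vec using ([]; _∷_)
open import Data.Product using (Σ; ∃; _×_; _,_)
open import Relation.Nullary using (¬_; Dec; yes; no)
open import Relation.Nullary.Decidable using (_×-dec_; ¬?; _→-dec_)
open import Relation.Binary.PropositionalEquality using (_≡_; _≢_)
open import Algebra.Core using (Op₁; Op₂)
open import Algebra.Structures using (IsCommutativeRing)

IsPrimePower : ℕ → Set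
IsPrimePower q = Σ ℕ λ p → Σ ℕ λ k → Prime p × 1 ≤ k × q ≡ p ^ k

-- A finite field with q elements, presented (up to isomorphism) with
-- carrier Fin q and propositional equality.
record FiniteField (q : ℕ) : Set where
  field
    _+_ _*_ : Op₂ (Fin q)
    -_      : Op₁ (Fin q)
    0# 1#   : Fin q
    isCommutativeRing : IsCommutativeRing _≡_ _+_ _*_ -_ 0# 1#
    0≢1     : 0# ≢ 1#
    inverse : ∀ x → x ≢ 0# → Σ (Fin q) λ y → x * y ≡ 1#

module Paley {q : ℕ} (F : FiniteField q) where
  open FiniteField F

  _-_ : Op₂ (Fin q)
  x - y = x + (- y)

  IsSquare : Fin q → Set
  IsSquare x = Σ (Fin q) λ y → y * y ≡ x

  isSquare? : ∀ x → Dec (IsSquare x)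
  isSquare? x = any? (λ y → (y * y) ≟ᶠ x)

  Adj : Fin q → Fin q → Set
  Adj x y = ¬ (x - y ≡ 0#) × IsSquare (x - y)

  adj? : ∀ x y → Dec (Adj x y)
  adj? x y = ¬? ((x - y) ≟ᶠ 0#) ×-dec isSquare? (x - y)

  degIn : Subset q → Fin q → ℕ
  degIn S v = length (filter (λ u → (u ∈? S) ×-dec adj? v u) (allFin q))

  Even : ℕ → Set
  Even n = n Data.Nat.% 2 ≡ 0

  IsEvenInduced : Subset q → Set
  IsEvenInduced S = ∀ v → v ∈ S → Even (degIn S v)

  isEvenInduced? : ∀ S → Dec (IsEvenInduced S)
  isEvenInduced? S = all? (λ v → (v ∈? S) →-dec (Data.Nat._≟_ (degIn S v Data.Nat.% 2) 0))

  CoEven : Subset q → Set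
  CoEven S = IsEvenInduced S × IsEvenInduced (∁ S)

  coEven? : ∀ S → Dec (CoEven S)
  coEven? S = isEvenInduced? S ×-dec isEvenInduced? (∁ S)

allSubsets : ∀ n → List (Subset n)
allSubsets zero = [] ∷ []
allSubsets (suc n) = map (outside ∷_) (allSubsets n) ++ map (inside ∷_) (allSubsets n)

numCoEven : ∀ {q} → FiniteField q → ℕ
numCoEven {q} F = length (filter (Paley.coEven? F) (allSubsets q))

{-# OPTIONS --safe #-}
-- Write q = 4m + 1, identify S ⊆ F_q with its indicator vector s ∈ GF(2)^q and let A be the adjacency
-- matrix of P_q over GF(2).  Every degree 2m is even, so S is co-even iff A s = 0, and N = |ker A|.  Two
-- vertices have 2m, m - 1 or m common neighbours according as their difference is 0, a residue or a
-- nonresidue; hence over GF(2), A² = A if m is even (q ≡ 1 mod 8) and A² = J + I + A if m is odd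
-- (q ≡ 5 mod 8).  In the odd case A s = 0 forces s = (Σ s)·1, so ker A = {0, 1}.  In the even case A
-- is idempotent, so |ker A|·|ker (I + A)| = 2^q; scaling by a nonresidue conjugates A to the
-- complement J + I + A, whose kernel has 2·|ker (I + A)| elements, so |ker A|² = 2^(q+1).
module Submission where

open import Data.Nat using (ℕ; suc; _%_) renaming (_+_ to _+ℕ_)
open import Relation.Binary.PropositionalEquality using (_≡_)
open import Defs using (IsPrimePower; FiniteField; module Paley; allSubsets; numCoEven)

module Counting where
  open import Algebra.Properties.CommutativeSemigroup using (interchange)
  open import Data.Bool using (Bool; true; false; not; _∧_)
  import Data.Bool.Properties as Bool
  open import Data.Empty using (⊥-elim)
  open import Data.Fin using (Fin; zero; suc)
  import Data.Fin.Properties as Fin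
  open import Data.Fin.Subset using (Subset; inside; outside)
  open import Data.List using (List; []; _∷_; _++_; map; length; allFin; filter)
  open import Data.List.Properties using (map-tabulate; length-tabulate)
  open import Data.Nat using (ℕ; suc; _+_; _*_)
  open import Data.Nat.Properties
    using (+-assoc; +-identityʳ; *-zeroʳ; *-identityʳ; *-distribˡ-+; *-distribʳ-+; m+n≡0⇒m≡0; +-commutativeSemigroup)
  open import Data.Product using (_×_; _,_; proj₁; proj₂; uncurry)
  open import Data.Product.Properties using (,-injective)
  open import Data.Sum using (_⊎_; inj₁; inj₂)
  open import Data.Vec using ([]; _∷_)
  import Data.Vec.Properties as Vec
  open import Relation.Binary.Definitions using (DecidableEquality)
  open import Relation.Binary.PropositionalEquality
  open import Relation.Nullary using (Dec; does; yes; no; _×-dec_)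
  open import Relation.Nullary.Decidable using (map′; dec-true; dec-false)
  open import Relation.Nullary.Negation using (contradiction)
  open import Relation.Unary using (Decidable)

  private variable A B : Set

  does≡true⇒ : ∀ {P : Set} (P? : Dec P) → does P? ≡ true → P
  does≡true⇒ (yes p) _ = p

  ∧-elimˡ : ∀ a {b} → a ∧ b ≡ true → a ≡ true
  ∧-elimˡ true _ = refl

  ∧-elimʳ : ∀ a {b} → a ∧ b ≡ true → b ≡ true
  ∧-elimʳ true e = e

  ∑ : List A → (A → ℕ) → ℕ
  ∑ []       f = 0
  ∑ (x ∷ xs) f = f x + ∑ xs f

  𝟙 : Bool → ℕ
  𝟙 false = 0
  𝟙 true  = 1

  count : (A → Bool) → List A → ℕ
  count p xs = ∑ xs (λ x → 𝟙 (p x))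

  ∑-cong : ∀ xs {f g : A → ℕ} → (∀ x → f x ≡ g x) → ∑ xs f ≡ ∑ xs g
  ∑-cong []       f≗g = refl
  ∑-cong (x ∷ xs) f≗g = cong₂ _+_ (f≗g x) (∑-cong xs f≗g)

  ∑-+ : ∀ xs (f g : A → ℕ) → ∑ xs (λ x → f x + g x) ≡ ∑ xs f + ∑ xs g
  ∑-+ []       f g = refl
  ∑-+ (x ∷ xs) f g = trans (cong (f x + g x +_) (∑-+ xs f g)) (interchange +-commutativeSemigroup (f x) (g x) _ _)

  ∑-*ˡ : ∀ xs c (f : A → ℕ) → ∑ xs (λ x → c * f x) ≡ c * ∑ xs f
  ∑-*ˡ []       c f = sym (*-zeroʳ c)
  ∑-*ˡ (x ∷ xs) c f = trans (cong (c * f x +_) (∑-*ˡ xs c f)) (sym (*-distribˡ-+ c (f x) _))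

  ∑-++ : ∀ xs ys (f : A → ℕ) → ∑ (xs ++ ys) f ≡ ∑ xs f + ∑ ys f
  ∑-++ []       ys f = refl
  ∑-++ (x ∷ xs) ys f = trans (cong (f x +_) (∑-++ xs ys f)) (sym (+-assoc (f x) _ _))

  ∑-map : ∀ xs (h : A → B) (f : B → ℕ) → ∑ (map h xs) f ≡ ∑ xs (λ x → f (h x))
  ∑-map []       h f = refl
  ∑-map (x ∷ xs) h f = cong (f (h x) +_) (∑-map xs h f)

  ∑-zero : ∀ xs {f : A → ℕ} → (∀ x → f x ≡ 0) → ∑ xs f ≡ 0
  ∑-zero []       f≗0 = refl
  ∑-zero (x ∷ xs) f≗0 = cong₂ _+_ (f≗0 x) (∑-zero xs f≗0)

  ∑-swap : ∀ xs ys (f : A → B → ℕ) → ∑ xs (λ x → ∑ ys (f x)) ≡ ∑ ys (λ y → ∑ xs (λ x → f x y))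
  ∑-swap []       ys f = sym (∑-zero ys (λ _ → refl))
  ∑-swap (x ∷ xs) ys f = trans (cong (∑ ys (f x) +_) (∑-swap xs ys f)) (sym (∑-+ ys (f x) _))

  count-cong : ∀ xs {p r : A → Bool} → (∀ x → p x ≡ r x) → count p xs ≡ count r xs
  count-cong xs p≗r = ∑-cong xs (λ x → cong 𝟙 (p≗r x))

  count-split : ∀ xs (p r : A → Bool) →
    count p xs ≡ count (λ x → p x ∧ r x) xs + count (λ x → p x ∧ not (r x)) xs
  count-split xs p r = trans (∑-cong xs split) (∑-+ xs _ _)
    where
    split : ∀ x → 𝟙 (p x) ≡ 𝟙 (p x ∧ r x) + 𝟙 (p x ∧ not (r x))
    split x with p x | r x
    ... | false | _     = refl
    ... | true  | true  = refl
    ... | true  | false = refl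

  count-true : ∀ (xs : List A) → count (λ _ → true) xs ≡ length xs
  count-true []       = refl
  count-true (x ∷ xs) = cong suc (count-true xs)

  count-true-allFin : ∀ n → count (λ _ → true) (allFin n) ≡ n
  count-true-allFin n = trans (count-true (allFin n)) (length-tabulate (λ x → x))

  length-filter : ∀ {P : A → Set} (P? : Decidable P) xs → length (filter P? xs) ≡ count (λ x → does (P? x)) xs
  length-filter P? []       = refl
  length-filter P? (x ∷ xs) with does (P? x)
  ... | true  = cong suc (length-filter P? xs)
  ... | false = length-filter P? xs

  pairs : List A → List B → List (A × B)
  pairs []       ys = []
  pairs (x ∷ xs) ys = map (x ,_) ys ++ pairs xs ys

  count-pairs : ∀ xs ys (p : A → Bool) (r : B → Bool) →
    count (λ z → p (proj₁ z) ∧ r (proj₂ z)) (pairs xs ys) ≡ count p xs * count r ys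
  count-pairs []       ys p r = refl
  count-pairs (x ∷ xs) ys p r = begin
    count (λ z → p (proj₁ z) ∧ r (proj₂ z)) (map (x ,_) ys ++ pairs xs ys)
      ≡⟨ ∑-++ (map (x ,_) ys) (pairs xs ys) _ ⟩
    count (λ z → p (proj₁ z) ∧ r (proj₂ z)) (map (x ,_) ys) + count (λ z → p (proj₁ z) ∧ r (proj₂ z)) (pairs xs ys)
      ≡⟨ cong₂ _+_ (trans (∑-map ys (x ,_) _) (trans (∑-cong ys (λ y → 𝟙-∧ (p x) (r y))) (∑-*ˡ ys (𝟙 (p x)) _)))
                   (count-pairs xs ys p r) ⟩
    𝟙 (p x) * count r ys + count p xs * count r ys
      ≡⟨ sym (*-distribʳ-+ (count r ys) (𝟙 (p x)) _) ⟩
    count p (x ∷ xs) * count r ys ∎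
    where
    open ≡-Reasoning
    𝟙-∧ : ∀ a b → 𝟙 (a ∧ b) ≡ 𝟙 a * 𝟙 b
    𝟙-∧ false b = refl
    𝟙-∧ true  b = sym (+-identityʳ (𝟙 b))

  record Enumeration (A : Set) : Set where
    field
      _≟_      : DecidableEquality A
      elements : List A
      once     : ∀ a → count (λ x → does (a ≟ x)) elements ≡ 1

  module _ (E : Enumeration A) where
    open Enumeration E

    ∑-point : ∀ a (f : A → ℕ) → (∀ x → a ≢ x → f x ≡ 0) → ∑ elements f ≡ f a
    ∑-point a f vanishes = begin
      ∑ elements f                                  ≡⟨ ∑-cong elements concentrated ⟩
      ∑ elements (λ x → f a * 𝟙 (does (a ≟ x)))     ≡⟨ ∑-*ˡ elements (f a) _ ⟩
      f a * count (λ x → does (a ≟ x)) elements     ≡⟨ cong (f a *_) (once a) ⟩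
      f a * 1                                       ≡⟨ *-identityʳ (f a) ⟩
      f a                                           ∎
      where
      open ≡-Reasoning
      concentrated : ∀ x → f x ≡ f a * 𝟙 (does (a ≟ x))
      concentrated x with a ≟ x
      ... | yes refl = sym (*-identityʳ (f a))
      ... | no a≢x   = trans (vanishes x a≢x) (sym (*-zeroʳ (f a)))

    count≡1 : ∀ (p : A → Bool) a → p a ≡ true → (∀ x → p x ≡ true → x ≡ a) → count p elements ≡ 1
    count≡1 p a pa unique = trans (∑-point a _ vanishes) (cong 𝟙 pa)
      where
      vanishes : ∀ x → a ≢ x → 𝟙 (p x) ≡ 0
      vanishes x a≢x with p x in px
      ... | false = refl
      ... | true  = ⊥-elim (a≢x (sym (unique x px)))

    count≡0⇒false : ∀ (p : A → Bool) → count p elements ≡ 0 → ∀ a → p a ≡ false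
    count≡0⇒false p none a with p a in pa
    ... | false = refl
    ... | true  = contradiction (begin
      1                                             ≡⟨ cong₂ (λ b c → 𝟙 (b ∧ c)) (sym pa) (sym (dec-true (a ≟ a) refl)) ⟩
      𝟙 (p a ∧ does (a ≟ a))                        ≡⟨ sym (∑-point a _ vanishes) ⟩
      count (λ x → p x ∧ does (a ≟ x)) elements     ≡⟨ m+n≡0⇒m≡0 _ (trans (sym (count-split elements p _)) none) ⟩
      0                                             ∎) λ ()
      where
      open ≡-Reasoning
      vanishes : ∀ x → a ≢ x → 𝟙 (p x ∧ does (a ≟ x)) ≡ 0
      vanishes x a≢x with a ≟ x
      ... | yes a≡x = ⊥-elim (a≢x a≡x)
      ... | no _    = cong 𝟙 (Bool.∧-zeroʳ (p x))

    count≡2 : ∀ (p : A → Bool) {a b} → a ≢ b → p a ≡ true → p b ≡ true → (∀ x → p x ≡ true → x ≡ a ⊎ x ≡ b) →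
      count p elements ≡ 2
    count≡2 p {a} {b} a≢b pa pb two = trans (count-split elements p (λ x → does (a ≟ x))) (cong₂ _+_ at-a at-b)
      where
      at-a : count (λ x → p x ∧ does (a ≟ x)) elements ≡ 1
      at-a = count≡1 _ a (cong₂ _∧_ pa (dec-true (a ≟ a) refl)) (λ x e → sym (does≡true⇒ (a ≟ x) (∧-elimʳ (p x) e)))
      at-b : count (λ x → p x ∧ not (does (a ≟ x))) elements ≡ 1
      at-b = count≡1 _ b (cong₂ _∧_ pb (cong not (dec-false (a ≟ b) a≢b))) only-b
        where
        only-b : ∀ x → p x ∧ not (does (a ≟ x)) ≡ true → x ≡ b
        only-b x e with two x (∧-elimˡ (p x) e)
        ... | inj₂ x≡b = x≡b
        ... | inj₁ x≡a = contradiction (trans (sym (cong not (dec-true (a ≟ x) (sym x≡a)))) (∧-elimʳ (p x) e)) λ ()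

  record BijectionBetween (p : A → Bool) (r : B → Bool) : Set where
    field
      to      : A → B
      from    : B → A
      to-∈    : ∀ a → p a ≡ true → r (to a) ≡ true
      from-∈  : ∀ b → r b ≡ true → p (from b) ≡ true
      from∘to : ∀ a → p a ≡ true → from (to a) ≡ a
      to∘from : ∀ b → r b ≡ true → to (from b) ≡ b

  count-bijection : (EA : Enumeration A) (EB : Enumeration B) {p : A → Bool} {r : B → Bool} →
    BijectionBetween p r → count p (Enumeration.elements EA) ≡ count r (Enumeration.elements EB)
  count-bijection {A = A} {B = B} EA EB {p} {r} bij = begin
    ∑ as (λ a → 𝟙 (p a))                       ≡⟨ ∑-cong as (λ a → sym (row a)) ⟩
    ∑ as (λ a → ∑ bs (λ b → incidence a b))    ≡⟨ ∑-swap as bs incidence ⟩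
    ∑ bs (λ b → ∑ as (λ a → incidence a b))    ≡⟨ ∑-cong bs column ⟩
    ∑ bs (λ b → 𝟙 (r b))                       ∎
    where
    open ≡-Reasoning
    open BijectionBetween bij
    open Enumeration EA using () renaming (elements to as; _≟_ to _≟A_)
    open Enumeration EB using () renaming (elements to bs)

    incidence : A → B → ℕ
    incidence a b = 𝟙 (r b ∧ does (from b ≟A a))

    incidence≡0 : ∀ a b → (r b ≡ true → from b ≢ a) → incidence a b ≡ 0
    incidence≡0 a b off with r b in rb
    ... | false = refl
    ... | true with from b ≟A a
    ...   | yes fb≡a = ⊥-elim (off refl fb≡a)
    ...   | no _     = refl

    row : ∀ a → ∑ bs (incidence a) ≡ 𝟙 (p a)
    row a with p a in pa
    ... | false = ∑-zero bs (λ b → incidence≡0 a b (λ rb fb≡a →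
                    contradiction (trans (sym pa) (trans (cong p (sym fb≡a)) (from-∈ b rb))) λ ()))
    ... | true = trans (∑-point EB (to a) (incidence a) off-image)
                       (cong₂ (λ c d → 𝟙 (c ∧ d)) (to-∈ a pa) (dec-true (from (to a) ≟A a) (from∘to a pa)))
      where
      off-image : ∀ b → to a ≢ b → incidence a b ≡ 0
      off-image b to-a≢b = incidence≡0 a b (λ rb fb≡a → to-a≢b (trans (cong to (sym fb≡a)) (to∘from b rb)))

    column : ∀ b → ∑ as (λ a → incidence a b) ≡ 𝟙 (r b)
    column b with r b in rb
    ... | false = ∑-zero as (λ a → refl)
    ... | true  = trans (∑-point EA (from b) _ (λ a fb≢a → cong 𝟙 (dec-false (from b ≟A a) fb≢a)))
                        (cong 𝟙 (dec-true (from b ≟A from b) refl))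

  boolEnumeration : Enumeration Bool
  boolEnumeration = record { _≟_ = Bool._≟_ ; elements = true ∷ false ∷ [] ; once = λ { true → refl ; false → refl } }

  finEnumeration : ∀ n → Enumeration (Fin n)
  finEnumeration n = record { _≟_ = Fin._≟_ ; elements = allFin n ; once = once }
    where
    once : ∀ {n} (a : Fin n) → count (λ x → does (a Fin.≟ x)) (allFin n) ≡ 1
    once {suc n} a = trans (cong (count (λ x → does (a Fin.≟ x))) allFin-suc) (once-suc a)
      where
      allFin-suc : allFin (suc n) ≡ zero ∷ map suc (allFin n)
      allFin-suc = cong (zero ∷_) (sym (map-tabulate (λ x → x) suc))
      once-suc : ∀ a → count (λ x → does (a Fin.≟ x)) (zero ∷ map suc (allFin n)) ≡ 1
      once-suc zero    = cong suc (trans (∑-map (allFin n) suc _) (∑-zero (allFin n) (λ _ → refl)))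
      once-suc (suc b) = trans (∑-map (allFin n) suc _) (once b)

  subsetEnumeration : ∀ n → Enumeration (Subset n)
  subsetEnumeration n = record { _≟_ = Vec.≡-dec Bool._≟_ ; elements = allSubsets n ; once = once }
    where
    once : ∀ {n} (S : Subset n) → count (λ T → does (Vec.≡-dec Bool._≟_ S T)) (allSubsets n) ≡ 1
    once {ℕ.zero} []      = refl
    once {suc n}  (b ∷ S) = trans (∑-++ (map (outside ∷_) (allSubsets n)) _ _)
      (trans (cong₂ _+_ (∑-map (allSubsets n) _ _) (∑-map (allSubsets n) _ _)) (split b))
      where
      split : ∀ b → count (λ T → does (b Bool.≟ outside) ∧ does (Vec.≡-dec Bool._≟_ S T)) (allSubsets n)
                  + count (λ T → does (b Bool.≟ inside) ∧ does (Vec.≡-dec Bool._≟_ S T)) (allSubsets n) ≡ 1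
      split false = cong₂ _+_ (once S) (∑-zero (allSubsets n) (λ _ → refl))
      split true  = cong₂ _+_ (∑-zero (allSubsets n) (λ _ → refl)) (once S)

  _×ₑ_ : Enumeration A → Enumeration B → Enumeration (A × B)
  EA ×ₑ EB = record { _≟_ = _≟×_ ; elements = pairs (elements EA) (elements EB) ; once = once× }
    where
    open Enumeration
    _≟×_ : DecidableEquality _
    (a , b) ≟× (c , d) = map′ (uncurry (cong₂ _,_)) ,-injective (_≟_ EA a c ×-dec _≟_ EB b d)
    once× : ∀ z → count (λ w → does (z ≟× w)) (pairs (elements EA) (elements EB)) ≡ 1
    once× (a , b) = trans (count-pairs (elements EA) (elements EB) _ _) (cong₂ _*_ (once EA a) (once EB b))

  count-permute : (E : Enumeration A) (π π⁻¹ : A → A) → (∀ x → π (π⁻¹ x) ≡ x) → (∀ x → π⁻¹ (π x) ≡ x) →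
    ∀ p → count (λ x → p (π x)) (Enumeration.elements E) ≡ count p (Enumeration.elements E)
  count-permute E π π⁻¹ π∘π⁻¹ π⁻¹∘π p = count-bijection E E (record
    { to = π ; from = π⁻¹ ; to-∈ = λ _ e → e ; from-∈ = λ b e → trans (cong p (π∘π⁻¹ b)) e
    ; from∘to = λ a _ → π⁻¹∘π a ; to∘from = λ b _ → π∘π⁻¹ b })

module Parity where
  open import Algebra.Bundles using (CommutativeRing)
  open import Algebra.Properties.CommutativeSemigroup using (interchange)
  open import Data.Bool using (Bool; true; false; not; _∧_; _xor_)
  open import Data.Bool.Properties
    using (not-distribˡ-xor; not-involutive; xor-same; xor-assoc; xor-identityʳ; ∧-distribˡ-xor; ∧-zeroʳ; xor-∧-commutativeRing)
  open import Data.Fin using (Fin)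
  open import Data.Fin.Properties using (_≟_; _<?_; <-cmp; <-asym; <-irrefl)
  open import Data.List using (List; []; _∷_; allFin)
  open import Data.Nat using (ℕ; zero; suc; _+_; _*_; _%_; _/_)
  open import Data.Nat.DivMod using (m≡m%n+[m/n]*n; [m+kn]%n≡m%n)
  open import Data.Nat.Tactic.RingSolver using (solve-∀)
  open import Relation.Binary.Definitions using (tri<; tri≈; tri>)
  open import Relation.Binary.PropositionalEquality
  open import Relation.Nullary using (does)
  open import Relation.Nullary.Decidable using (dec-true; dec-false)
  open import Relation.Nullary.Negation using (contradiction)
  open Counting

  private variable A B : Set

  isOdd : ℕ → Bool
  isOdd zero    = false
  isOdd (suc n) = not (isOdd n)

  isOdd-+ : ∀ m n → isOdd (m + n) ≡ isOdd m xor isOdd n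
  isOdd-+ zero    n = refl
  isOdd-+ (suc m) n = trans (cong not (isOdd-+ m n)) (not-distribˡ-xor (isOdd m) (isOdd n))

  isOdd-double : ∀ n → isOdd (n + n) ≡ false
  isOdd-double n = trans (isOdd-+ n n) (xor-same (isOdd n))

  n%2≡𝟙[isOdd-n] : ∀ n → n % 2 ≡ 𝟙 (isOdd n)
  n%2≡𝟙[isOdd-n] zero          = refl
  n%2≡𝟙[isOdd-n] (suc zero)    = refl
  n%2≡𝟙[isOdd-n] (suc (suc n)) = trans (n%2≡𝟙[isOdd-n] n) (cong 𝟙 (sym (not-involutive (isOdd n))))

  n%2≡0⇒even : ∀ n → n % 2 ≡ 0 → isOdd n ≡ false
  n%2≡0⇒even n n%2≡0 with isOdd n | n%2≡𝟙[isOdd-n] n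
  ... | false | _    = refl
  ... | true  | n%2≡1 = contradiction (trans (sym n%2≡1) n%2≡0) λ ()

  even⇒n%2≡0 : ∀ n → isOdd n ≡ false → n % 2 ≡ 0
  even⇒n%2≡0 n n-even = trans (n%2≡𝟙[isOdd-n] n) (cong 𝟙 n-even)

  [1+4m]%8≡1+4[isOdd-m] : ∀ m → suc ((m + m) + (m + m)) % 8 ≡ 1 + 4 * 𝟙 (isOdd m)
  [1+4m]%8≡1+4[isOdd-m] m = begin
    suc ((m + m) + (m + m)) % 8             ≡⟨ cong (λ n → suc ((n + n) + (n + n)) % 8) (m≡m%n+[m/n]*n m 2) ⟩
    suc ((m′ + m′) + (m′ + m′)) % 8          ≡⟨ cong (_% 8) (regroup (m % 2) (m / 2)) ⟩
    (1 + 4 * (m % 2) + (m / 2) * 8) % 8     ≡⟨ [m+kn]%n≡m%n (1 + 4 * (m % 2)) (m / 2) 8 ⟩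
    (1 + 4 * (m % 2)) % 8                   ≡⟨ cong (λ r → (1 + 4 * r) % 8) (n%2≡𝟙[isOdd-n] m) ⟩
    (1 + 4 * 𝟙 (isOdd m)) % 8               ≡⟨ below-8 (isOdd m) ⟩
    1 + 4 * 𝟙 (isOdd m)                     ∎
    where
    open ≡-Reasoning
    m′ = m % 2 + m / 2 * 2
    regroup : ∀ r j → suc (((r + j * 2) + (r + j * 2)) + ((r + j * 2) + (r + j * 2))) ≡ 1 + 4 * r + j * 8
    regroup = solve-∀
    below-8 : ∀ b → (1 + 4 * 𝟙 b) % 8 ≡ 1 + 4 * 𝟙 b
    below-8 false = refl
    below-8 true  = refl

  [x⊕y]⊕y≡x : ∀ x y → (x xor y) xor y ≡ x
  [x⊕y]⊕y≡x x y = trans (xor-assoc x y y) (trans (cong (x xor_) (xor-same y)) (xor-identityʳ x))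

  x⊕y≡0⇒y≡x : ∀ {x y} → x xor y ≡ false → y ≡ x
  x⊕y≡0⇒y≡x {false} {false} _ = refl
  x⊕y≡0⇒y≡x {true}  {true}  _ = refl

  ⨁ : List A → (A → Bool) → Bool
  ⨁ []       f = false
  ⨁ (x ∷ xs) f = f x xor ⨁ xs f

  isOdd-𝟙 : ∀ b → isOdd (𝟙 b) ≡ b
  isOdd-𝟙 false = refl
  isOdd-𝟙 true  = refl

  isOdd-count : ∀ xs (p : A → Bool) → isOdd (count p xs) ≡ ⨁ xs p
  isOdd-count []       p = refl
  isOdd-count (x ∷ xs) p = trans (isOdd-+ (𝟙 (p x)) (count p xs)) (cong₂ _xor_ (isOdd-𝟙 (p x)) (isOdd-count xs p))

  ⨁-cong : ∀ xs {f g : A → Bool} → (∀ x → f x ≡ g x) → ⨁ xs f ≡ ⨁ xs g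
  ⨁-cong []       f≗g = refl
  ⨁-cong (x ∷ xs) f≗g = cong₂ _xor_ (f≗g x) (⨁-cong xs f≗g)

  ⨁-false : ∀ (xs : List A) → ⨁ xs (λ _ → false) ≡ false
  ⨁-false []       = refl
  ⨁-false (x ∷ xs) = ⨁-false xs

  ⨁-xor : ∀ xs (f g : A → Bool) → ⨁ xs (λ x → f x xor g x) ≡ ⨁ xs f xor ⨁ xs g
  ⨁-xor []       f g = refl
  ⨁-xor (x ∷ xs) f g = trans (cong ((f x xor g x) xor_) (⨁-xor xs f g))
    (interchange (CommutativeRing.+-commutativeSemigroup xor-∧-commutativeRing) (f x) (g x) (⨁ xs f) (⨁ xs g))

  ⨁-∧ˡ : ∀ xs b (f : A → Bool) → ⨁ xs (λ x → b ∧ f x) ≡ b ∧ ⨁ xs f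
  ⨁-∧ˡ []       b f = sym (∧-zeroʳ b)
  ⨁-∧ˡ (x ∷ xs) b f = trans (cong ((b ∧ f x) xor_) (⨁-∧ˡ xs b f)) (sym (∧-distribˡ-xor b (f x) (⨁ xs f)))

  ⨁-swap : ∀ xs ys (f : A → B → Bool) → ⨁ xs (λ x → ⨁ ys (f x)) ≡ ⨁ ys (λ y → ⨁ xs (λ x → f x y))
  ⨁-swap []       ys f = sym (⨁-false ys)
  ⨁-swap (x ∷ xs) ys f = trans (cong (⨁ ys (f x) xor_) (⨁-swap xs ys f)) (sym (⨁-xor ys (f x) _))

  ⨁-point : (E : Enumeration A) → ∀ a (f : A → Bool) → (∀ x → a ≢ x → f x ≡ false) → ⨁ (Enumeration.elements E) f ≡ f a
  ⨁-point E a f vanishes = begin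
    ⨁ (Enumeration.elements E) f              ≡⟨ sym (isOdd-count (Enumeration.elements E) f) ⟩
    isOdd (count f (Enumeration.elements E))  ≡⟨ cong isOdd (∑-point E a _ (λ x a≢x → cong 𝟙 (vanishes x a≢x))) ⟩
    isOdd (𝟙 (f a))                            ≡⟨ isOdd-𝟙 (f a) ⟩
    f a                                        ∎
    where open ≡-Reasoning

  ⨁-permute : (E : Enumeration A) (π π⁻¹ : A → A) → (∀ x → π (π⁻¹ x) ≡ x) → (∀ x → π⁻¹ (π x) ≡ x) →
    ∀ p → ⨁ (Enumeration.elements E) (λ x → p (π x)) ≡ ⨁ (Enumeration.elements E) p
  ⨁-permute E π π⁻¹ π∘π⁻¹ π⁻¹∘π p = begin
    ⨁ xs (λ x → p (π x))            ≡⟨ sym (isOdd-count xs _) ⟩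
    isOdd (count (λ x → p (π x)) xs) ≡⟨ cong isOdd (count-permute E π π⁻¹ π∘π⁻¹ π⁻¹∘π p) ⟩
    isOdd (count p xs)               ≡⟨ isOdd-count xs p ⟩
    ⨁ xs p                           ∎
    where
    open ≡-Reasoning
    xs = Enumeration.elements E

  involution-parity : ∀ {n} (f : Fin n → Fin n) → (∀ x → f (f x) ≡ x) → (p : Fin n → Bool) → (∀ x → p (f x) ≡ p x) →
    isOdd (count p (allFin n)) ≡ isOdd (count (λ x → p x ∧ does (x ≟ f x)) (allFin n))
  involution-parity {n} f f∘f p p∘f = begin
    isOdd (count p xs)                     ≡⟨ cong isOdd (trans (∑-cong xs split) (trans (∑-+ xs _ _) (cong (fixed +_) (∑-+ xs _ _)))) ⟩
    isOdd (fixed + (below + above))        ≡⟨ cong (λ a → isOdd (fixed + (below + a))) above≡below ⟩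
    isOdd (fixed + (below + below))        ≡⟨ isOdd-+ fixed (below + below) ⟩
    isOdd fixed xor isOdd (below + below)  ≡⟨ cong (isOdd fixed xor_) (isOdd-double below) ⟩
    isOdd fixed xor false                  ≡⟨ xor-identityʳ (isOdd fixed) ⟩
    isOdd fixed                            ∎
    where
    open ≡-Reasoning
    xs = allFin n
    fixed below above : ℕ
    fixed = count (λ x → p x ∧ does (x ≟ f x)) xs
    below = count (λ x → p x ∧ does (x <? f x)) xs
    above = count (λ x → p x ∧ does (f x <? x)) xs

    split : ∀ x → 𝟙 (p x) ≡ 𝟙 (p x ∧ does (x ≟ f x)) + (𝟙 (p x ∧ does (x <? f x)) + 𝟙 (p x ∧ does (f x <? x)))
    split x with p x | <-cmp x (f x)
    ... | false | _ = refl
    ... | true  | tri< x<fx x≢fx _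
      rewrite dec-false (x ≟ f x) x≢fx | dec-true (x <? f x) x<fx | dec-false (f x <? x) (<-asym x<fx) = refl
    ... | true  | tri≈ _ x≡fx _
      rewrite dec-true (x ≟ f x) x≡fx | dec-false (x <? f x) (<-irrefl x≡fx) | dec-false (f x <? x) (<-irrefl (sym x≡fx)) = refl
    ... | true  | tri> _ x≢fx fx<x
      rewrite dec-false (x ≟ f x) x≢fx | dec-false (x <? f x) (<-asym fx<x) | dec-true (f x <? x) fx<x = refl

    above≡below : above ≡ below
    above≡below = trans (sym (count-permute (finEnumeration n) f f f∘f f∘f _))
                        (count-cong xs (λ x → cong₂ _∧_ (p∘f x) (cong (λ y → does (y <? f x)) (f∘f x))))

module FieldArithmetic {q : ℕ} (F : FiniteField q) where
  open import Algebra.Bundles using (CommutativeRing)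
  open import Algebra.Properties.CommutativeSemigroup using (x∙yz≈yx∙z; xy∙z≈xz∙y)
  open import Data.Empty using (⊥-elim)
  open import Data.Bool using (Bool)
  open import Data.Fin using (Fin)
  open import Data.Fin.Properties using (_≟_)
  open import Data.List using (List; allFin)
  open import Data.Product using (proj₁; proj₂)
  open import Data.Sum using (_⊎_; inj₁; inj₂)
  open import Relation.Binary.PropositionalEquality
  open import Relation.Nullary using (Dec; yes; no)
  open Counting using (count; count-permute; finEnumeration)
  open FiniteField F using (0≢1; inverse)

  commutativeRing : CommutativeRing _ _
  commutativeRing = record { isCommutativeRing = FiniteField.isCommutativeRing F }

  open CommutativeRing commutativeRing public
    using (_+_; _*_; -_; _-_; 0#; 1#; +-assoc; +-identityˡ; +-identityʳ; -‿inverseˡ; -‿inverseʳ;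
           *-comm; *-assoc; *-identityˡ; *-identityʳ; distribˡ; distribʳ; zeroˡ; zeroʳ)
  open CommutativeRing commutativeRing using (ring; +-commutativeSemigroup)
  open import Algebra.Properties.Ring ring public
    using (-1*x≈-x; -‿distribˡ-*; -‿distribʳ-*; x[y-z]≈xy-xz; -‿involutive; -0#≈0#; +-cancelˡ)
    renaming (x∙y⁻¹≈ε⇒x≈y to x-y≡0⇒x≡y; ⁻¹-anti-homo‿- to -‿anti-homo‿-; //-rightDividesʳ to x+y-y≡x)
  open import Algebra.Properties.Ring ring using (-‿+-comm; \\-leftDividesˡ)

  x-y-z≡x-z-y : ∀ x y z → x - y - z ≡ x - z - y
  x-y-z≡x-z-y x y z = xy∙z≈xz∙y +-commutativeSemigroup x (- y) (- z)

  x-[x-y]≡y : ∀ x y → x - (x - y) ≡ y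
  x-[x-y]≡y x y = begin
    x + - (x - y)   ≡⟨ cong (x +_) (-‿anti-homo‿- x y) ⟩
    x + (y - x)     ≡⟨ x∙yz≈yx∙z +-commutativeSemigroup x y (- x) ⟩
    y + x - x       ≡⟨ x+y-y≡x x y ⟩
    y               ∎
    where open ≡-Reasoning

  -x*-y≡x*y : ∀ x y → - x * - y ≡ x * y
  -x*-y≡x*y x y = trans (sym (-‿distribˡ-* x (- y))) (trans (cong -_ (sym (-‿distribʳ-* x y))) (-‿involutive (x * y)))

  -x≡0⇒x≡0 : ∀ {x} → - x ≡ 0# → x ≡ 0#
  -x≡0⇒x≡0 {x} -x≡0 = trans (sym (-‿involutive x)) (trans (cong -_ -x≡0) -0#≈0#)

  [x-y][x+y]≡x²-y² : ∀ x y → (x - y) * (x + y) ≡ x * x - y * y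
  [x-y][x+y]≡x²-y² x y = begin
    (x - y) * (x + y)                   ≡⟨ distribʳ (x + y) x (- y) ⟩
    x * (x + y) + - y * (x + y)         ≡⟨ cong₂ _+_ (distribˡ x x y) (sym (-‿distribˡ-* y (x + y))) ⟩
    (x * x + x * y) + - (y * (x + y))   ≡⟨ cong (λ z → (x * x + x * y) + - z) (trans (distribˡ y x y) (cong (_+ y * y) (*-comm y x))) ⟩
    (x * x + x * y) + - (x * y + y * y) ≡⟨ cong ((x * x + x * y) +_) (sym (-‿+-comm (x * y) (y * y))) ⟩
    (x * x + x * y) + (- (x * y) - y * y) ≡⟨ +-assoc (x * x) (x * y) _ ⟩
    x * x + (x * y + (- (x * y) - y * y)) ≡⟨ cong (x * x +_) (\\-leftDividesˡ (x * y) (- (y * y))) ⟩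
    x * x - y * y                       ∎
    where open ≡-Reasoning

  -- 0# ⁻¹ is the junk value 0#; this makes ⁻¹ an involution of the whole field.
  _⁻¹ : Fin q → Fin q
  x ⁻¹ with x ≟ 0#
  ... | yes _   = 0#
  ... | no x≢0  = proj₁ (inverse x x≢0)

  0⁻¹≡0 : 0# ⁻¹ ≡ 0#
  0⁻¹≡0 with 0# ≟ 0#
  ... | yes _   = refl
  ... | no 0≢0  = ⊥-elim (0≢0 refl)

  x*x⁻¹≡1 : ∀ {x} → x ≢ 0# → x * x ⁻¹ ≡ 1#
  x*x⁻¹≡1 {x} x≢0 with x ≟ 0#
  ... | yes x≡0  = ⊥-elim (x≢0 x≡0)
  ... | no x≢0′  = proj₂ (inverse x x≢0′)

  x⁻¹*x≡1 : ∀ {x} → x ≢ 0# → x ⁻¹ * x ≡ 1#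
  x⁻¹*x≡1 {x} x≢0 = trans (*-comm (x ⁻¹) x) (x*x⁻¹≡1 x≢0)

  x⁻¹*[x*y]≡y : ∀ {x} y → x ≢ 0# → x ⁻¹ * (x * y) ≡ y
  x⁻¹*[x*y]≡y {x} y x≢0 = trans (sym (*-assoc (x ⁻¹) x y)) (trans (cong (_* y) (x⁻¹*x≡1 x≢0)) (*-identityˡ y))

  x*[x⁻¹*y]≡y : ∀ {x} y → x ≢ 0# → x * (x ⁻¹ * y) ≡ y
  x*[x⁻¹*y]≡y {x} y x≢0 = trans (sym (*-assoc x (x ⁻¹) y)) (trans (cong (_* y) (x*x⁻¹≡1 x≢0)) (*-identityˡ y))

  x*y*y⁻¹≡x : ∀ x {y} → y ≢ 0# → x * y * y ⁻¹ ≡ x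
  x*y*y⁻¹≡x x {y} y≢0 = trans (*-assoc x y (y ⁻¹)) (trans (cong (x *_) (x*x⁻¹≡1 y≢0)) (*-identityʳ x))

  *-cancelˡ : ∀ {a} x y → a ≢ 0# → a * x ≡ a * y → x ≡ y
  *-cancelˡ {a} x y a≢0 ax≡ay = begin
    x                  ≡⟨ sym (x⁻¹*[x*y]≡y x a≢0) ⟩
    a ⁻¹ * (a * x)     ≡⟨ cong (a ⁻¹ *_) ax≡ay ⟩
    a ⁻¹ * (a * y)     ≡⟨ x⁻¹*[x*y]≡y y a≢0 ⟩
    y                  ∎
    where open ≡-Reasoning

  x*y≡0⇒x≡0⊎y≡0 : ∀ x y → x * y ≡ 0# → x ≡ 0# ⊎ y ≡ 0#
  x*y≡0⇒x≡0⊎y≡0 x y xy≡0 with x ≟ 0#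
  ... | yes x≡0 = inj₁ x≡0
  ... | no x≢0  = inj₂ (*-cancelˡ y 0# x≢0 (trans xy≡0 (sym (zeroʳ x))))

  x*y≢0 : ∀ {x y} → x ≢ 0# → y ≢ 0# → x * y ≢ 0#
  x*y≢0 {x} {y} x≢0 y≢0 xy≡0 with x*y≡0⇒x≡0⊎y≡0 x y xy≡0
  ... | inj₁ x≡0 = x≢0 x≡0
  ... | inj₂ y≡0 = y≢0 y≡0

  x⁻¹≢0 : ∀ {x} → x ≢ 0# → x ⁻¹ ≢ 0#
  x⁻¹≢0 {x} x≢0 x⁻¹≡0 = 0≢1 (begin
    0#            ≡⟨ sym (zeroʳ x) ⟩
    x * 0#        ≡⟨ cong (x *_) (sym x⁻¹≡0) ⟩
    x * x ⁻¹      ≡⟨ x*x⁻¹≡1 x≢0 ⟩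
    1#            ∎)
    where open ≡-Reasoning

  x*y≡1⇒y≡x⁻¹ : ∀ {x y} → x * y ≡ 1# → y ≡ x ⁻¹
  x*y≡1⇒y≡x⁻¹ {x} {y} xy≡1 = *-cancelˡ y (x ⁻¹) x≢0 (trans xy≡1 (sym (x*x⁻¹≡1 x≢0)))
    where
    x≢0 : x ≢ 0#
    x≢0 x≡0 = 0≢1 (trans (sym (zeroˡ y)) (trans (cong (_* y) (sym x≡0)) xy≡1))

  ⁻¹-involutive : ∀ x → x ⁻¹ ⁻¹ ≡ x
  ⁻¹-involutive x = by-cases (x ≟ 0#)
    where
    by-cases : Dec (x ≡ 0#) → x ⁻¹ ⁻¹ ≡ x
    by-cases (yes refl) = trans (cong _⁻¹ 0⁻¹≡0) 0⁻¹≡0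
    by-cases (no x≢0)   = *-cancelˡ (x ⁻¹ ⁻¹) x (x⁻¹≢0 x≢0) (trans (x*x⁻¹≡1 (x⁻¹≢0 x≢0)) (sym (x⁻¹*x≡1 x≢0)))

  𝔽 : List (Fin q)
  𝔽 = allFin q

  count-scale : ∀ {d} → d ≢ 0# → (p : Fin q → Bool) → count (λ x → p (d * x)) 𝔽 ≡ count p 𝔽
  count-scale {d} d≢0 = count-permute (finEnumeration q) (d *_) (d ⁻¹ *_) (λ x → x*[x⁻¹*y]≡y x d≢0) (λ x → x⁻¹*[x*y]≡y x d≢0)

  count-reflect : ∀ v (p : Fin q → Bool) → count (λ x → p (v - x)) 𝔽 ≡ count p 𝔽
  count-reflect v = count-permute (finEnumeration q) (λ x → v - x) (λ x → v - x) (x-[x-y]≡y v) (x-[x-y]≡y v)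

  x*x≡y*y⇒x≡y⊎x≡-y : ∀ x y → x * x ≡ y * y → x ≡ y ⊎ x ≡ - y
  x*x≡y*y⇒x≡y⊎x≡-y x y x²≡y²
    with x*y≡0⇒x≡0⊎y≡0 (x - y) (x + y) (trans ([x-y][x+y]≡x²-y² x y) (trans (cong (_- y * y) x²≡y²) (-‿inverseʳ (y * y))))
  ... | inj₁ x-y≡0 = inj₁ (x-y≡0⇒x≡y x y x-y≡0)
  ... | inj₂ x+y≡0 = inj₂ (x-y≡0⇒x≡y x (- y) (trans (cong (x +_) (-‿involutive y)) x+y≡0))

module QuadraticResidues {q : ℕ} (F : FiniteField q) where
  open import Algebra.Bundles using (CommutativeRing)
  open import Data.Bool using (Bool; true; false; not; _∧_; _xor_)
  open import Data.Fin using (Fin)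
  open import Data.Fin.Properties using (_≟_)
  open import Data.Product using (_×_; _,_; proj₁)
  open import Data.Sum using (_⊎_; inj₁; inj₂)
  open import Function.Bundles using (_⇔_; mk⇔; Equivalence)
  open import Relation.Binary.PropositionalEquality
  open import Relation.Nullary using (Dec; does; yes; no; ¬_; ¬?; _×-dec_)
  open import Relation.Nullary.Decidable using (does-⇔)
  open import Relation.Unary using (Decidable)
  open FieldArithmetic F
  open import Algebra.Properties.CommutativeSemigroup (CommutativeRing.*-commutativeSemigroup commutativeRing)
    using (interchange)
  open Paley F using (IsSquare; isSquare?)
  open Counting

  Residue Nonresidue : Fin q → Set
  Residue    x = x ≢ 0# × IsSquare x
  Nonresidue x = x ≢ 0# × ¬ IsSquare x

  residue? : Decidable Residue
  residue? x = ¬? (x ≟ 0#) ×-dec isSquare? x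

  nonresidue? : Decidable Nonresidue
  nonresidue? x = ¬? (x ≟ 0#) ×-dec ¬? (isSquare? x)

  isZero isResidue isNonresidue : Fin q → Bool
  isZero       x = does (x ≟ 0#)
  isResidue    x = does (residue? x)
  isNonresidue x = does (nonresidue? x)

  IsSquare-* : ∀ {x y} → IsSquare x → IsSquare y → IsSquare (x * y)
  IsSquare-* (r , r²≡x) (s , s²≡y) = r * s , trans (interchange r s r s) (cong₂ _*_ r²≡x s²≡y)

  Residue-* : ∀ {x y} → Residue x → Residue y → Residue (x * y)
  Residue-* (x≢0 , □x) (y≢0 , □y) = x*y≢0 x≢0 y≢0 , IsSquare-* □x □y

  IsSquare-⁻¹ : ∀ {x} → IsSquare x → IsSquare (x ⁻¹)
  IsSquare-⁻¹ {x} = by-cases (x ≟ 0#)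
    where
    by-cases : Dec (x ≡ 0#) → IsSquare x → IsSquare (x ⁻¹)
    by-cases (yes x≡0) _          = 0# , trans (zeroˡ 0#) (sym (trans (cong _⁻¹ x≡0) 0⁻¹≡0))
    by-cases (no x≢0)  (r , r²≡x) = r ⁻¹ , x*y≡1⇒y≡x⁻¹ (begin
      x * (r ⁻¹ * r ⁻¹)         ≡⟨ cong (_* (r ⁻¹ * r ⁻¹)) (sym r²≡x) ⟩
      (r * r) * (r ⁻¹ * r ⁻¹)   ≡⟨ interchange r r (r ⁻¹) (r ⁻¹) ⟩
      (r * r ⁻¹) * (r * r ⁻¹)   ≡⟨ cong₂ _*_ (x*x⁻¹≡1 r≢0) (x*x⁻¹≡1 r≢0) ⟩
      1# * 1#                   ≡⟨ *-identityˡ 1# ⟩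
      1#                        ∎)
      where
      open ≡-Reasoning
      r≢0 : r ≢ 0#
      r≢0 r≡0 = x≢0 (trans (sym r²≡x) (trans (cong (_* r) r≡0) (zeroˡ r)))

  isResidue-cong : ∀ {x y} → (x ≡ 0# ⇔ y ≡ 0#) → (IsSquare x ⇔ IsSquare y) → isResidue x ≡ isResidue y
  isResidue-cong {x} {y} zero⇔ square⇔ =
    cong₂ (λ z s → not z ∧ s) (does-⇔ zero⇔ (x ≟ 0#) (y ≟ 0#)) (does-⇔ square⇔ (isSquare? x) (isSquare? y))

  isNonresidue-cong : ∀ {x y} → (x ≡ 0# ⇔ y ≡ 0#) → (IsSquare x ⇔ IsSquare y) → isNonresidue x ≡ isNonresidue y
  isNonresidue-cong {x} {y} zero⇔ square⇔ =
    cong₂ (λ z s → not z ∧ not s) (does-⇔ zero⇔ (x ≟ 0#) (y ≟ 0#)) (does-⇔ square⇔ (isSquare? x) (isSquare? y))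

  *-zero⇔ : ∀ {d} y → d ≢ 0# → (d * y ≡ 0# ⇔ y ≡ 0#)
  *-zero⇔ {d} y d≢0 = mk⇔ (λ dy≡0 → *-cancelˡ y 0# d≢0 (trans dy≡0 (sym (zeroʳ d))))
                          (λ y≡0 → trans (cong (d *_) y≡0) (zeroʳ d))

  *-square⇔ : ∀ {d} y → Residue d → (IsSquare (d * y) ⇔ IsSquare y)
  *-square⇔ {d} y (d≢0 , □d) = mk⇔ (λ □dy → subst IsSquare (x⁻¹*[x*y]≡y y d≢0) (IsSquare-* (IsSquare-⁻¹ □d) □dy))
                                    (IsSquare-* □d)

  isResidue-* : ∀ {d} y → Residue d → isResidue (d * y) ≡ isResidue y
  isResidue-* y Rd = isResidue-cong (*-zero⇔ y (proj₁ Rd)) (*-square⇔ y Rd)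

  isNonresidue-* : ∀ {d} y → Residue d → isNonresidue (d * y) ≡ isNonresidue y
  isNonresidue-* y Rd = isNonresidue-cong (*-zero⇔ y (proj₁ Rd)) (*-square⇔ y Rd)

  ⁻¹-zero⇔ : ∀ x → (x ⁻¹ ≡ 0# ⇔ x ≡ 0#)
  ⁻¹-zero⇔ x = mk⇔ (λ x⁻¹≡0 → trans (sym (⁻¹-involutive x)) (trans (cong _⁻¹ x⁻¹≡0) 0⁻¹≡0))
                   (λ x≡0 → trans (cong _⁻¹ x≡0) 0⁻¹≡0)

  ⁻¹-square⇔ : ∀ x → (IsSquare (x ⁻¹) ⇔ IsSquare x)
  ⁻¹-square⇔ x = mk⇔ (λ □x⁻¹ → subst IsSquare (⁻¹-involutive x) (IsSquare-⁻¹ □x⁻¹)) IsSquare-⁻¹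

  Nonresidue-⁻¹ : ∀ {x} → Nonresidue x → Nonresidue (x ⁻¹)
  Nonresidue-⁻¹ {x} (x≢0 , ¬□x) = x⁻¹≢0 x≢0 , λ □x⁻¹ → ¬□x (Equivalence.to (⁻¹-square⇔ x) □x⁻¹)

  isResidue-⁻¹ : ∀ x → isResidue (x ⁻¹) ≡ isResidue x
  isResidue-⁻¹ x = isResidue-cong (⁻¹-zero⇔ x) (⁻¹-square⇔ x)

  isNonresidue-⁻¹ : ∀ x → isNonresidue (x ⁻¹) ≡ isNonresidue x
  isNonresidue-⁻¹ x = isNonresidue-cong (⁻¹-zero⇔ x) (⁻¹-square⇔ x)

  residuosity : ∀ x → x ≡ 0# ⊎ Residue x ⊎ Nonresidue x
  residuosity x with x ≟ 0# | isSquare? x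
  ... | yes x≡0 | _      = inj₁ x≡0
  ... | no x≢0  | yes □x = inj₂ (inj₁ (x≢0 , □x))
  ... | no x≢0  | no ¬□x = inj₂ (inj₂ (x≢0 , ¬□x))

  isNonresidue≡¬zero⊕residue : ∀ y → isNonresidue y ≡ (true xor isZero y) xor isResidue y
  isNonresidue≡¬zero⊕residue y with y ≟ 0# | isSquare? y
  ... | yes _ | _     = refl
  ... | no _  | yes _ = refl
  ... | no _  | no _  = refl

  count-by-residuosity : ∀ xs (p : Fin q → Bool) (h : Fin q → Fin q) →
    count p xs ≡ count (λ t → p t ∧ isResidue (h t)) xs
                 +ℕ (count (λ t → p t ∧ isNonresidue (h t)) xs +ℕ count (λ t → p t ∧ isZero (h t)) xs)
  count-by-residuosity xs p h = trans (∑-cong xs split) (trans (∑-+ xs R _) (cong (∑ xs R +ℕ_) (∑-+ xs N _)))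
    where
    R N : Fin q → ℕ
    R t = 𝟙 (p t ∧ isResidue (h t))
    N t = 𝟙 (p t ∧ isNonresidue (h t))
    split : ∀ t → 𝟙 (p t) ≡ 𝟙 (p t ∧ isResidue (h t)) +ℕ (𝟙 (p t ∧ isNonresidue (h t)) +ℕ 𝟙 (p t ∧ isZero (h t)))
    split t with p t | h t ≟ 0# | isSquare? (h t)
    ... | false | _     | _     = refl
    ... | true  | yes _ | _     = refl
    ... | true  | no _  | yes _ = refl
    ... | true  | no _  | no _  = refl

module OddOrder {q : ℕ} (F : FiniteField q) (k : ℕ) (q≡1+2k : q ≡ suc (k +ℕ k)) where
  open import Data.Bool using (Bool; true; false; not; _∧_)
  open import Data.Empty using (⊥-elim)
  open import Data.Fin using (Fin)
  open import Data.Fin.Properties using (_≟_; any?)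
  open import Data.Nat using () renaming (_*_ to _*ℕ_)
  import Data.Nat.Properties as ℕ
  open import Data.Product using (Σ; _×_; _,_; proj₂)
  open import Data.Sum using (inj₁; inj₂)
  open import Relation.Binary.PropositionalEquality
  open import Relation.Nullary using (Dec; does; yes; no; ¬?; _×-dec_)
  open import Relation.Nullary.Decidable using (dec-true; dec-false)
  open import Relation.Nullary.Negation using (contradiction)
  open FieldArithmetic F
  open QuadraticResidues F
  open Paley F using (IsSquare; isSquare?)
  open Counting
  open Parity
  open FiniteField F using (0≢1)

  isOdd-q : isOdd q ≡ true
  isOdd-q = trans (cong isOdd q≡1+2k) (cong not (isOdd-double k))

  1+1≢0 : 1# + 1# ≢ 0#
  1+1≢0 1+1≡0 = contradiction (begin
    true                                                 ≡⟨ trans (sym isOdd-q) (cong isOdd (sym (count-true-allFin q))) ⟩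
    isOdd (count (λ _ → true) 𝔽)                         ≡⟨ involution-parity _+1 +1+1 (λ _ → true) (λ _ → refl) ⟩
    isOdd (count (λ x → does (x ≟ x + 1#)) 𝔽)           ≡⟨ cong isOdd (∑-zero 𝔽 (λ x → cong 𝟙 (dec-false (x ≟ x + 1#) (x≢x+1 x)))) ⟩
    false                                                ∎) λ ()
    where
    open ≡-Reasoning
    _+1 : Fin q → Fin q
    x +1 = x + 1#
    +1+1 : ∀ x → (x + 1#) + 1# ≡ x
    +1+1 x = trans (+-assoc x 1# 1#) (trans (cong (x +_) 1+1≡0) (+-identityʳ x))
    x≢x+1 : ∀ x → x ≢ x + 1#
    x≢x+1 x x≡x+1 = 0≢1 (+-cancelˡ x 0# 1# (trans (+-identityʳ x) x≡x+1))

  -x≢x : ∀ {x} → x ≢ 0# → - x ≢ x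
  -x≢x {x} x≢0 -x≡x = x≢0 (*-cancelˡ x 0# 1+1≢0 (begin
    (1# + 1#) * x   ≡⟨ distribʳ x 1# 1# ⟩
    1# * x + 1# * x ≡⟨ cong₂ _+_ (*-identityˡ x) (*-identityˡ x) ⟩
    x + x           ≡⟨ cong (_+ x) (sym -x≡x) ⟩
    - x + x         ≡⟨ -‿inverseˡ x ⟩
    0#              ≡⟨ sym (zeroʳ (1# + 1#)) ⟩
    (1# + 1#) * 0#  ∎))
    where open ≡-Reasoning

  count-isZero : count isZero 𝔽 ≡ 1
  count-isZero = count≡1 (finEnumeration q) isZero 0# (dec-true (0# ≟ 0#) refl) (λ x → does≡true⇒ (x ≟ 0#))

  count-nonzero : count (λ x → not (isZero x)) 𝔽 ≡ k +ℕ k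
  count-nonzero = ℕ.suc-injective (begin
    suc (count (λ x → not (isZero x)) 𝔽)                     ≡⟨ cong (_+ℕ count (λ x → not (isZero x)) 𝔽) (sym count-isZero) ⟩
    count isZero 𝔽 +ℕ count (λ x → not (isZero x)) 𝔽        ≡⟨ sym (count-split 𝔽 (λ _ → true) isZero) ⟩
    count (λ _ → true) 𝔽                                     ≡⟨ trans (count-true-allFin q) q≡1+2k ⟩
    suc (k +ℕ k)                                             ∎)
    where open ≡-Reasoning

  √ : Fin q → Fin q
  √ x with isSquare? x
  ... | yes (r , _) = r
  ... | no _        = 0#

  √x*√x≡x : ∀ {x} → IsSquare x → √ x * √ x ≡ x
  √x*√x≡x {x} □x with isSquare? x
  ... | yes (r , r²≡x) = r²≡x
  ... | no ¬□x         = ⊥-elim (¬□x □x)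

  √x≢0 : ∀ {x} → Residue x → √ x ≢ 0#
  √x≢0 {x} (x≢0 , □x) √x≡0 = x≢0 (trans (sym (√x*√x≡x □x)) (trans (cong (_* √ x) √x≡0) (zeroˡ (√ x))))

  -- x ↦ (whether x is the chosen root of x², x²) is a bijection from the nonzero elements to Bool × residues.
  count-residue : count isResidue 𝔽 ≡ k
  count-residue = ℕ.*-cancelˡ-≡ _ _ 2 (begin
    2 *ℕ count isResidue 𝔽                                    ≡⟨ sym (count-pairs bools 𝔽 (λ _ → true) isResidue) ⟩
    count (λ z → true ∧ isResidue (proj₂ z)) (pairs bools 𝔽)  ≡⟨ sym (count-bijection (finEnumeration q) Bool×𝔽 squaring) ⟩
    count (λ x → not (isZero x)) 𝔽                           ≡⟨ count-nonzero ⟩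
    k +ℕ k                                                    ≡⟨ cong (k +ℕ_) (sym (ℕ.+-identityʳ k)) ⟩
    2 *ℕ k                                                    ∎)
    where
    open ≡-Reasoning
    bools = Enumeration.elements boolEnumeration
    Bool×𝔽 = boolEnumeration ×ₑ finEnumeration q

    root : Bool × Fin q → Fin q
    root (true  , s) = √ s
    root (false , s) = - √ s

    root≢0 : ∀ b {s} → Residue s → root (b , s) ≢ 0#
    root≢0 true  Rs = √x≢0 Rs
    root≢0 false Rs = λ -√s≡0 → √x≢0 Rs (-x≡0⇒x≡0 -√s≡0)

    root-square : ∀ x → x ≢ 0# → root (does (x ≟ √ (x * x)) , x * x) ≡ x
    root-square x x≢0 with x ≟ √ (x * x)
    ... | yes x≡√x² = sym x≡√x²
    ... | no x≢√x² with x*x≡y*y⇒x≡y⊎x≡-y (√ (x * x)) x (√x*√x≡x (x , refl))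
    ...   | inj₁ √x²≡x  = ⊥-elim (x≢√x² (sym √x²≡x))
    ...   | inj₂ √x²≡-x = trans (cong -_ √x²≡-x) (-‿involutive x)

    square-root : ∀ b {s} → Residue s → (does (root (b , s) ≟ √ (root (b , s) * root (b , s))) , root (b , s) * root (b , s)) ≡ (b , s)
    square-root true  {s} (_ , □s) rewrite √x*√x≡x □s = cong (_, s) (dec-true (√ s ≟ √ s) refl)
    square-root false {s} Rs@(_ , □s) rewrite -x*-y≡x*y (√ s) (√ s) | √x*√x≡x □s =
      cong (_, s) (dec-false (- √ s ≟ √ s) (-x≢x (√x≢0 Rs)))

    squaring : BijectionBetween (λ x → not (isZero x)) (λ z → true ∧ isResidue (proj₂ z))
    squaring = record
      { to      = λ x → does (x ≟ √ (x * x)) , x * x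
      ; from    = root
      ; to-∈    = λ x x≢0 → dec-true (residue? (x * x)) (x*y≢0 (nonzero x≢0) (nonzero x≢0) , x , refl)
      ; from-∈  = λ (b , s) Rs → dec-true (¬? (root (b , s) ≟ 0#)) (root≢0 b (does≡true⇒ (residue? s) Rs))
      ; from∘to = λ x x≢0 → root-square x (nonzero x≢0)
      ; to∘from = λ (b , s) Rs → square-root b (does≡true⇒ (residue? s) Rs)
      }
      where
      nonzero : ∀ {x} → not (isZero x) ≡ true → x ≢ 0#
      nonzero {x} = does≡true⇒ (¬? (x ≟ 0#))

  count-nonresidue : count isNonresidue 𝔽 ≡ k
  count-nonresidue = ℕ.suc-injective (ℕ.+-cancelˡ-≡ k _ _ (begin
    k +ℕ suc N                                       ≡⟨ cong (k +ℕ_) (ℕ.+-comm 1 N) ⟩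
    k +ℕ (N +ℕ 1)                                    ≡⟨ cong₂ (λ r z → r +ℕ (N +ℕ z)) (sym count-residue) (sym count-isZero) ⟩
    count isResidue 𝔽 +ℕ (N +ℕ count isZero 𝔽)      ≡⟨ sym (count-by-residuosity 𝔽 (λ _ → true) (λ x → x)) ⟩
    count (λ _ → true) 𝔽                             ≡⟨ trans (count-true-allFin q) q≡1+2k ⟩
    suc (k +ℕ k)                                     ≡⟨ sym (ℕ.+-suc k k) ⟩
    k +ℕ suc k                                       ∎))
    where
    open ≡-Reasoning
    N = count isNonresidue 𝔽

  Residue-1 : Residue 1#
  Residue-1 = (λ 1≡0 → 0≢1 (sym 1≡0)) , 1# , *-identityˡ 1#

  nonresidue-exists : Σ (Fin q) Nonresidue
  nonresidue-exists with any? nonresidue?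
  ... | yes ∃N = ∃N
  ... | no ∄N  = contradiction (begin
    true          ≡⟨ sym (dec-true (residue? 1#) Residue-1) ⟩
    isResidue 1#  ≡⟨ count≡0⇒false (finEnumeration q) isResidue no-residues 1# ⟩
    false         ∎) λ ()
    where
    open ≡-Reasoning
    no-residues : count isResidue 𝔽 ≡ 0
    no-residues = trans count-residue (trans (sym count-nonresidue)
                    (∑-zero 𝔽 (λ x → cong 𝟙 (dec-false (nonresidue? x) (λ Nx → ∄N (x , Nx))))))

  -- Multiplication by a maps the k residues injectively into the k nonresidues, hence onto them.
  nonresidue*nonresidue : ∀ {a b} → Nonresidue a → Nonresidue b → Residue (a * b)
  nonresidue*nonresidue {a} {b} (a≢0 , ¬□a) Nb = subst Residue a²[a⁻¹b]≡ab (Residue-* Residue-a² Residue-a⁻¹b)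
    where
    E = finEnumeration q

    shifted? : ∀ y → Dec (Nonresidue y × Residue (a ⁻¹ * y))
    shifted? y = nonresidue? y ×-dec residue? (a ⁻¹ * y)

    a*residue : BijectionBetween isResidue (λ y → does (shifted? y))
    a*residue = record
      { to      = a *_
      ; from    = a ⁻¹ *_
      ; to-∈    = λ s Rs → to-∈ s (does≡true⇒ (residue? s) Rs)
      ; from-∈  = λ y e → dec-true (residue? _) (proj₂ (does≡true⇒ (shifted? y) e))
      ; from∘to = λ s _ → x⁻¹*[x*y]≡y s a≢0
      ; to∘from = λ y _ → x*[x⁻¹*y]≡y y a≢0
      }
      where
      to-∈ : ∀ s → Residue s → does (shifted? (a * s)) ≡ true
      to-∈ s Rs@(s≢0 , □s) = dec-true (shifted? (a * s))
        ( (x*y≢0 a≢0 s≢0 , λ □as → ¬□a (subst IsSquare (x*y*y⁻¹≡x a s≢0) (IsSquare-* □as (IsSquare-⁻¹ □s))))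
        , subst Residue (sym (x⁻¹*[x*y]≡y s a≢0)) Rs)

    no-others : count (λ y → isNonresidue y ∧ not (isResidue (a ⁻¹ * y))) 𝔽 ≡ 0
    no-others = ℕ.+-cancelˡ-≡ k _ 0 (begin
      k +ℕ count (λ y → isNonresidue y ∧ not (isResidue (a ⁻¹ * y))) 𝔽
        ≡⟨ cong (_+ℕ _) (trans (sym count-residue) (count-bijection E E a*residue)) ⟩
      count (λ y → does (shifted? y)) 𝔽 +ℕ count (λ y → isNonresidue y ∧ not (isResidue (a ⁻¹ * y))) 𝔽
        ≡⟨ sym (count-split 𝔽 isNonresidue (λ y → isResidue (a ⁻¹ * y))) ⟩
      count isNonresidue 𝔽
        ≡⟨ trans count-nonresidue (sym (ℕ.+-identityʳ k)) ⟩
      k +ℕ 0 ∎)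
      where open ≡-Reasoning

    Residue-a⁻¹b : Residue (a ⁻¹ * b)
    Residue-a⁻¹b with residue? (a ⁻¹ * b)
    ... | yes R = R
    ... | no ¬R = contradiction (begin
      true                                          ≡⟨ sym (cong₂ (λ n r → n ∧ not r) (dec-true (nonresidue? b) Nb) (dec-false (residue? (a ⁻¹ * b)) ¬R)) ⟩
      isNonresidue b ∧ not (isResidue (a ⁻¹ * b))   ≡⟨ count≡0⇒false E _ no-others b ⟩
      false                                         ∎) λ ()
      where open ≡-Reasoning

    Residue-a² : Residue (a * a)
    Residue-a² = x*y≢0 a≢0 a≢0 , a , refl

    a²[a⁻¹b]≡ab : (a * a) * (a ⁻¹ * b) ≡ a * b
    a²[a⁻¹b]≡ab = trans (*-assoc a a _) (cong (a *_) (x*[x⁻¹*y]≡y b a≢0))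

  isResidue-*-nonresidue : ∀ {d} y → Nonresidue d → isResidue (d * y) ≡ isNonresidue y
  isResidue-*-nonresidue {d} y Nd@(d≢0 , ¬□d) with y ≟ 0#
  ... | yes y≡0 = dec-false (residue? (d * y)) (λ (dy≢0 , _) → dy≢0 (trans (cong (d *_) y≡0) (zeroʳ d)))
  ... | no y≢0 with isSquare? y
  ...   | yes □y = dec-false (residue? (d * y))
                     (λ (_ , □dy) → ¬□d (subst IsSquare (x*y*y⁻¹≡x d y≢0) (IsSquare-* □dy (IsSquare-⁻¹ □y))))
  ...   | no ¬□y = dec-true (residue? (d * y)) (nonresidue*nonresidue Nd (y≢0 , ¬□y))

  isNonresidue-*-nonresidue : ∀ {d} y → Nonresidue d → isNonresidue (d * y) ≡ isResidue y
  isNonresidue-*-nonresidue {d} y Nd@(d≢0 , _) = begin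
    isNonresidue (d * y)        ≡⟨ sym (isResidue-*-nonresidue (d * y) Nd) ⟩
    isResidue (d * (d * y))     ≡⟨ cong isResidue (sym (*-assoc d d y)) ⟩
    isResidue ((d * d) * y)     ≡⟨ isResidue-* y (x*y≢0 d≢0 d≢0 , d , refl) ⟩
    isResidue y                 ∎
    where open ≡-Reasoning

module Cyclotomy {q : ℕ} (F : FiniteField q) (m : ℕ) (q≡1+4m : q ≡ suc ((m +ℕ m) +ℕ (m +ℕ m))) where
  open import Data.Bool using (Bool; true; false; _∧_)
  open import Data.Bool.Properties using (∧-comm; ∧-idem)
  open import Data.Empty using (⊥-elim)
  open import Data.Fin using (Fin)
  open import Data.Fin.Properties using (_≟_)
  import Data.Nat.Properties as ℕ
  open import Data.Product using (_,_; proj₁; proj₂)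
  open import Data.Sum using (inj₁; inj₂)
  open import Relation.Binary.PropositionalEquality
  open import Relation.Nullary using (does; yes; no; _×-dec_)
  open import Relation.Nullary.Decidable using (dec-true; dec-false)
  open import Relation.Nullary.Negation using (contradiction)
  open FieldArithmetic F
  open QuadraticResidues F
  open Paley F using (IsSquare)
  open OddOrder F (m +ℕ m) q≡1+4m public
  open Counting
  open Parity

  -- Inversion is an involution on the 2m residues; its fixed points are the square roots of 1.
  Residue[-1] : Residue (- 1#)
  Residue[-1] with residue? (- 1#)
  ... | yes R-1  = R-1
  ... | no ¬R-1 = contradiction (begin
    false                                               ≡⟨ sym (isOdd-double m) ⟩
    isOdd (m +ℕ m)                                      ≡⟨ cong isOdd (sym count-residue) ⟩
    isOdd (count isResidue 𝔽)                           ≡⟨ involution-parity _⁻¹ ⁻¹-involutive isResidue isResidue-⁻¹ ⟩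
    isOdd (count (λ x → isResidue x ∧ does (x ≟ x ⁻¹)) 𝔽) ≡⟨ cong isOdd (count≡1 (finEnumeration q) _ 1# fixed-1 fixed⇒1) ⟩
    true                                                ∎) λ ()
    where
    open ≡-Reasoning
    1≡1⁻¹ : 1# ≡ 1# ⁻¹
    1≡1⁻¹ = x*y≡1⇒y≡x⁻¹ (*-identityˡ 1#)
    fixed-1 : does (residue? 1# ×-dec (1# ≟ 1# ⁻¹)) ≡ true
    fixed-1 = dec-true (residue? 1# ×-dec (1# ≟ 1# ⁻¹)) (Residue-1 , 1≡1⁻¹)
    fixed⇒1 : ∀ x → does (residue? x ×-dec (x ≟ x ⁻¹)) ≡ true → x ≡ 1#
    fixed⇒1 x e with does≡true⇒ (residue? x ×-dec (x ≟ x ⁻¹)) e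
    ... | Rx@(x≢0 , _) , x≡x⁻¹ with x*x≡y*y⇒x≡y⊎x≡-y x 1# (trans (cong (x *_) x≡x⁻¹) (trans (x*x⁻¹≡1 x≢0) (sym (*-identityˡ 1#))))
    ...   | inj₁ x≡1  = x≡1
    ...   | inj₂ x≡-1 = ⊥-elim (¬R-1 (subst Residue x≡-1 Rx))

  isResidue-neg : ∀ x → isResidue (- x) ≡ isResidue x
  isResidue-neg x = trans (cong isResidue (sym (-1*x≈-x x))) (isResidue-* x Residue[-1])

  isNonresidue-neg : ∀ x → isNonresidue (- x) ≡ isNonresidue x
  isNonresidue-neg x = trans (cong isNonresidue (sym (-1*x≈-x x))) (isNonresidue-* x Residue[-1])

  commonNeighbours : Fin q → ℕ
  commonNeighbours d = count (λ t → isResidue t ∧ isResidue (d - t)) 𝔽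

  cyclotomic : (Fin q → Bool) → (Fin q → Bool) → ℕ
  cyclotomic P Q = count (λ s → P s ∧ Q (1# - s)) 𝔽

  private
    RR RN NR NN : ℕ
    RR = cyclotomic isResidue    isResidue
    RN = cyclotomic isResidue    isNonresidue
    NR = cyclotomic isNonresidue isResidue
    NN = cyclotomic isNonresidue isNonresidue

  commonNeighbours-0 : commonNeighbours 0# ≡ m +ℕ m
  commonNeighbours-0 = trans (count-cong 𝔽 same) count-residue
    where
    same : ∀ t → isResidue t ∧ isResidue (0# - t) ≡ isResidue t
    same t = trans (cong (isResidue t ∧_) (trans (cong isResidue (+-identityˡ (- t))) (isResidue-neg t))) (∧-idem (isResidue t))

  d-d*s≡d*[1-s] : ∀ d s → d - d * s ≡ d * (1# - s)
  d-d*s≡d*[1-s] d s = sym (trans (x[y-z]≈xy-xz d 1# s) (cong (_- d * s) (*-identityʳ d)))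

  commonNeighbours-residue : ∀ {d} → Residue d → commonNeighbours d ≡ RR
  commonNeighbours-residue {d} Rd = trans (sym (count-scale (proj₁ Rd) _)) (count-cong 𝔽 (λ s →
    cong₂ _∧_ (isResidue-* s Rd) (trans (cong isResidue (d-d*s≡d*[1-s] d s)) (isResidue-* (1# - s) Rd))))

  commonNeighbours-nonresidue : ∀ {d} → Nonresidue d → commonNeighbours d ≡ NN
  commonNeighbours-nonresidue {d} Nd = trans (sym (count-scale (proj₁ Nd) _)) (count-cong 𝔽 (λ s →
    cong₂ _∧_ (isResidue-*-nonresidue s Nd) (trans (cong isResidue (d-d*s≡d*[1-s] d s)) (isResidue-*-nonresidue (1# - s) Nd))))

  RN≡NR : RN ≡ NR
  RN≡NR = trans (count-cong 𝔽 swap) (count-reflect 1# _)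
    where
    swap : ∀ s → isResidue s ∧ isNonresidue (1# - s) ≡ isNonresidue (1# - s) ∧ isResidue (1# - (1# - s))
    swap s = trans (∧-comm (isResidue s) _) (cong (λ t → isNonresidue (1# - s) ∧ isResidue t) (sym (x-[x-y]≡y 1# s)))

  NN≡NR : NN ≡ NR
  NN≡NR = trans (count-cong 𝔽 pointwise) (count-permute (finEnumeration q) _⁻¹ _⁻¹ ⁻¹-involutive ⁻¹-involutive _)
    where
    1-s⁻¹≡s⁻¹*[s-1] : ∀ {s} → s ≢ 0# → 1# - s ⁻¹ ≡ s ⁻¹ * (s - 1#)
    1-s⁻¹≡s⁻¹*[s-1] {s} s≢0 = sym (trans (x[y-z]≈xy-xz (s ⁻¹) s 1#) (cong₂ _-_ (x⁻¹*x≡1 s≢0) (*-identityʳ (s ⁻¹))))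
    pointwise : ∀ s → isNonresidue s ∧ isNonresidue (1# - s) ≡ isNonresidue (s ⁻¹) ∧ isResidue (1# - s ⁻¹)
    pointwise s with nonresidue? s
    ... | no ¬Ns = trans (cong (_∧ isNonresidue (1# - s)) (dec-false (nonresidue? s) ¬Ns))
                         (sym (cong (_∧ isResidue (1# - s ⁻¹)) (trans (isNonresidue-⁻¹ s) (dec-false (nonresidue? s) ¬Ns))))
    ... | yes Ns@(s≢0 , _) = begin
      isNonresidue s ∧ isNonresidue (1# - s)            ≡⟨ cong (_∧ isNonresidue (1# - s)) (dec-true (nonresidue? s) Ns) ⟩
      isNonresidue (1# - s)                             ≡⟨ trans (sym (isNonresidue-neg (1# - s))) (cong isNonresidue (-‿anti-homo‿- 1# s)) ⟩
      isNonresidue (s - 1#)                             ≡⟨ sym (isResidue-*-nonresidue (s - 1#) (Nonresidue-⁻¹ Ns)) ⟩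
      isResidue (s ⁻¹ * (s - 1#))                       ≡⟨ cong₂ _∧_ (sym (trans (isNonresidue-⁻¹ s) (dec-true (nonresidue? s) Ns)))
                                                                     (cong isResidue (sym (1-s⁻¹≡s⁻¹*[s-1] s≢0))) ⟩
      isNonresidue (s ⁻¹) ∧ isResidue (1# - s ⁻¹)       ∎
      where open ≡-Reasoning

  residue-row : RR +ℕ (RN +ℕ 1) ≡ m +ℕ m
  residue-row = begin
    RR +ℕ (RN +ℕ 1)                                               ≡⟨ cong (λ z → RR +ℕ (RN +ℕ z)) (sym only-1) ⟩
    RR +ℕ (RN +ℕ count (λ s → isResidue s ∧ isZero (1# - s)) 𝔽)   ≡⟨ sym (count-by-residuosity 𝔽 isResidue (λ s → 1# - s)) ⟩
    count isResidue 𝔽                                             ≡⟨ count-residue ⟩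
    m +ℕ m                                                        ∎
    where
    open ≡-Reasoning
    only-1 : count (λ s → isResidue s ∧ isZero (1# - s)) 𝔽 ≡ 1
    only-1 = count≡1 (finEnumeration q) _ 1# (dec-true (residue? 1# ×-dec (1# - 1# ≟ 0#)) (Residue-1 , -‿inverseʳ 1#))
               (λ s e → sym (x-y≡0⇒x≡y 1# s (proj₂ (does≡true⇒ (residue? s ×-dec (1# - s ≟ 0#)) e))))

  nonresidue-row : NR +ℕ (NN +ℕ 0) ≡ m +ℕ m
  nonresidue-row = begin
    NR +ℕ (NN +ℕ 0)                                                ≡⟨ cong (λ z → NR +ℕ (NN +ℕ z)) (sym none) ⟩
    NR +ℕ (NN +ℕ count (λ s → isNonresidue s ∧ isZero (1# - s)) 𝔽) ≡⟨ sym (count-by-residuosity 𝔽 isNonresidue (λ s → 1# - s)) ⟩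
    count isNonresidue 𝔽                                           ≡⟨ count-nonresidue ⟩
    m +ℕ m                                                         ∎
    where
    open ≡-Reasoning
    none : count (λ s → isNonresidue s ∧ isZero (1# - s)) 𝔽 ≡ 0
    none = ∑-zero 𝔽 (λ s → cong 𝟙 (dec-false (nonresidue? s ×-dec (1# - s ≟ 0#))
             (λ ((_ , ¬□s) , 1-s≡0) → ¬□s (subst IsSquare (x-y≡0⇒x≡y 1# s 1-s≡0) (proj₂ Residue-1)))))

  NR≡m : NR ≡ m
  NR≡m = ℕ.*-cancelˡ-≡ NR m 2 (begin
    NR +ℕ (NR +ℕ 0)  ≡⟨ cong (λ z → NR +ℕ (z +ℕ 0)) (sym NN≡NR) ⟩
    NR +ℕ (NN +ℕ 0)  ≡⟨ nonresidue-row ⟩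
    m +ℕ m           ≡⟨ cong (m +ℕ_) (sym (ℕ.+-identityʳ m)) ⟩
    m +ℕ (m +ℕ 0)    ∎)
    where open ≡-Reasoning

  commonNeighbours-nonresidue≡m : ∀ {d} → Nonresidue d → commonNeighbours d ≡ m
  commonNeighbours-nonresidue≡m Nd = trans (commonNeighbours-nonresidue Nd) (trans NN≡NR NR≡m)

  1+commonNeighbours-residue≡m : ∀ {d} → Residue d → suc (commonNeighbours d) ≡ m
  1+commonNeighbours-residue≡m {d} Rd = ℕ.+-cancelʳ-≡ m _ _ (begin
    suc (commonNeighbours d) +ℕ m   ≡⟨ cong (λ c → suc c +ℕ m) (commonNeighbours-residue Rd) ⟩
    suc RR +ℕ m           ≡⟨ sym (ℕ.+-suc RR m) ⟩
    RR +ℕ suc m           ≡⟨ cong (λ n → RR +ℕ n) (ℕ.+-comm 1 m) ⟩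
    RR +ℕ (m +ℕ 1)        ≡⟨ cong (λ n → RR +ℕ (n +ℕ 1)) (sym (trans RN≡NR NR≡m)) ⟩
    RR +ℕ (RN +ℕ 1)       ≡⟨ residue-row ⟩
    m +ℕ m                ∎)
    where open ≡-Reasoning

module BinaryKernels (n : ℕ) where
  open import Data.Bool using (Bool; true; false; not; _∧_; _xor_)
  open import Data.Bool.Properties using (xor-same; not-involutive; xor-annihilates-not; ∧-identityʳ; ∧-zeroʳ)
  import Data.Bool.Properties as Bool
  open import Data.Fin using (Fin; zero; suc)
  open import Data.Fin.Properties using (all?)
  open import Data.Fin.Subset using (Subset; ∁; ⊥; ⊤; inside; outside)
  open import Data.Fin.Subset.Properties using (_∈?_)
  open import Data.List using (allFin; length; map)
  open import Data.List.Properties using (length-++; length-map)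
  open import Data.Nat using (zero; _*_; _^_)
  import Data.Nat.Properties as ℕ
  open import Data.Product using (Σ; _×_; _,_; proj₁; proj₂)
  open import Data.Sum using (_⊎_; inj₁; inj₂)
  open import Data.Vec using (lookup; tabulate; replicate; _∷_)
  open import Data.Vec.Properties using (lookup∘tabulate; tabulate∘lookup; tabulate-cong; lookup-map; lookup-replicate)
  open import Function.Bundles using (mk⇔)
  open import Relation.Binary.PropositionalEquality
  open import Relation.Nullary using (Dec; does; _×-dec_)
  open import Relation.Nullary.Decidable using (does-⇔; dec-true; dec-false)
  open import Relation.Nullary.Negation using (contradiction)
  open Counting
  open Parity

  𝔹ⁿ : Set
  𝔹ⁿ = Fin n → Bool

  infixl 6 _⊕_
  _⊕_ : 𝔹ⁿ → 𝔹ⁿ → 𝔹ⁿ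
  (s ⊕ t) v = s v xor t v

  const : Bool → 𝔹ⁿ
  const b _ = b

  total : 𝔹ⁿ → Bool
  total s = ⨁ (allFin n) s

  IsZero : 𝔹ⁿ → Set
  IsZero s = ∀ v → s v ≡ false

  isZero? : ∀ s → Dec (IsZero s)
  isZero? s = all? (λ v → s v Bool.≟ false)

  Congruent Additive : (𝔹ⁿ → 𝔹ⁿ) → Set
  Congruent f = ∀ {s t} → s ≗ t → f s ≗ f t
  Additive  f = ∀ s t → f (s ⊕ t) ≗ f s ⊕ f t

  inKernel? : (𝔹ⁿ → 𝔹ⁿ) → Subset n → Bool
  inKernel? f S = does (isZero? (f (lookup S)))

  does-∈ : ∀ {n} (u : Fin n) (S : Subset n) → does (u ∈? S) ≡ lookup S u
  does-∈ zero    (inside  ∷ S) = refl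
  does-∈ zero    (outside ∷ S) = refl
  does-∈ (suc u) (_       ∷ S) = does-∈ u S

  ∣ker_∣ : (𝔹ⁿ → 𝔹ⁿ) → ℕ
  ∣ker f ∣ = count (inKernel? f) (allSubsets n)

  tabulate-≗ : ∀ {g : 𝔹ⁿ} (S : Subset n) → g ≗ lookup S → tabulate g ≡ S
  tabulate-≗ S g≗S = trans (tabulate-cong g≗S) (tabulate∘lookup S)

  lookup-injective : ∀ {S T : Subset n} → lookup S ≗ lookup T → S ≡ T
  lookup-injective {S} {T} S≗T = trans (sym (tabulate∘lookup S)) (tabulate-≗ T S≗T)

  lookup-∁ : ∀ (S : Subset n) → lookup (∁ S) ≗ λ v → not (lookup S v)
  lookup-∁ S v = lookup-map v not S

  ∁-involutive : ∀ (S : Subset n) → ∁ (∁ S) ≡ S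
  ∁-involutive S = lookup-injective (λ v → trans (lookup-∁ (∁ S) v) (trans (cong not (lookup-∁ S v)) (not-involutive (lookup S v))))

  isZero-≗ : ∀ {s t} → s ≗ t → does (isZero? s) ≡ does (isZero? t)
  isZero-≗ s≗t = does-⇔ (mk⇔ (λ z v → trans (sym (s≗t v)) (z v)) (λ z v → trans (s≗t v) (z v))) (isZero? _) (isZero? _)

  ∣ker∣-cong : ∀ {f g} → (∀ s → f s ≗ g s) → ∣ker f ∣ ≡ ∣ker g ∣
  ∣ker∣-cong f≗g = count-cong (allSubsets n) (λ S → isZero-≗ (f≗g (lookup S)))

  count-subsets : count (λ _ → true) (allSubsets n) ≡ 2 ^ n
  count-subsets = trans (count-true (allSubsets n)) (length-allSubsets n)
    where
    length-allSubsets : ∀ n → length (allSubsets n) ≡ 2 ^ n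
    length-allSubsets zero    = refl
    length-allSubsets (suc n) = begin
      length (allSubsets (suc n))
        ≡⟨ length-++ (map _ (allSubsets n)) ⟩
      length (map _ (allSubsets n)) +ℕ length (map _ (allSubsets n))
        ≡⟨ cong₂ _+ℕ_ (length-map _ (allSubsets n)) (length-map _ (allSubsets n)) ⟩
      length (allSubsets n) +ℕ length (allSubsets n)
        ≡⟨ cong₂ _+ℕ_ (length-allSubsets n) (trans (length-allSubsets n) (sym (ℕ.+-identityʳ _))) ⟩
      2 ^ suc n
        ∎
      where open ≡-Reasoning

  -- An idempotent linear map splits 𝔹ⁿ as ker f × im f, and im f = ker (id ⊕ f).
  ∣ker∣*∣ker-id⊕∣≡2^n : ∀ {f} → Congruent f → Additive f → (∀ s → f (f s) ≗ f s) →
    ∣ker f ∣ * ∣ker (λ s → s ⊕ f s) ∣ ≡ 2 ^ n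
  ∣ker∣*∣ker-id⊕∣≡2^n {f} f-cong f-additive f∘f≗f = begin
    ∣ker f ∣ * ∣ker g ∣
      ≡⟨ sym (count-pairs (allSubsets n) (allSubsets n) (inKernel? f) (inKernel? g)) ⟩
    count (λ z → inKernel? f (proj₁ z) ∧ inKernel? g (proj₂ z)) (Enumeration.elements Subset²)
      ≡⟨ sym (count-bijection (subsetEnumeration n) Subset² splitting) ⟩
    count (λ _ → true) (allSubsets n)
      ≡⟨ count-subsets ⟩
    2 ^ n
      ∎
    where
    open ≡-Reasoning
    g : 𝔹ⁿ → 𝔹ⁿ
    g s = s ⊕ f s
    Subset² = subsetEnumeration n ×ₑ subsetEnumeration n

    f∘tabulate : ∀ h → f (lookup (tabulate h)) ≗ f h
    f∘tabulate h = f-cong (lookup∘tabulate h)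

    split : Subset n → Subset n × Subset n
    split S = tabulate (g (lookup S)) , tabulate (f (lookup S))

    join : Subset n × Subset n → Subset n
    join (P , Q) = tabulate (lookup P ⊕ lookup Q)

    split-∈ : ∀ S → inKernel? f (proj₁ (split S)) ∧ inKernel? g (proj₂ (split S)) ≡ true
    split-∈ S = dec-true (isZero? _ ×-dec isZero? _) (f-kills , g-kills)
      where
      s = lookup S
      f-kills : IsZero (f (lookup (tabulate (g s))))
      f-kills v = trans (f∘tabulate (g s) v) (trans (f-additive s (f s) v) (trans (cong (f s v xor_) (f∘f≗f s v)) (xor-same (f s v))))
      g-kills : IsZero (g (lookup (tabulate (f s))))
      g-kills v = trans (cong₂ _xor_ (lookup∘tabulate (f s) v) (f∘tabulate (f s) v)) (trans (cong (f s v xor_) (f∘f≗f s v)) (xor-same (f s v)))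

    join∘split : ∀ S → join (split S) ≡ S
    join∘split S = tabulate-≗ S (λ v → trans (cong₂ _xor_ (lookup∘tabulate (g (lookup S)) v) (lookup∘tabulate (f (lookup S)) v))
                                             ([x⊕y]⊕y≡x (lookup S v) (f (lookup S) v)))

    split∘join : ∀ z → inKernel? f (proj₁ z) ∧ inKernel? g (proj₂ z) ≡ true → split (join z) ≡ z
    split∘join (P , Q) e = cong₂ _,_ (tabulate-≗ P g-join≗P) (tabulate-≗ Q f-join≗Q)
      where
      kernels = does≡true⇒ (isZero? (f (lookup P)) ×-dec isZero? (g (lookup Q))) e
      f-join≗Q : f (lookup (join (P , Q))) ≗ lookup Q
      f-join≗Q v = begin
        f (lookup (join (P , Q))) v                ≡⟨ f∘tabulate (lookup P ⊕ lookup Q) v ⟩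
        f (lookup P ⊕ lookup Q) v                  ≡⟨ f-additive (lookup P) (lookup Q) v ⟩
        f (lookup P) v xor f (lookup Q) v          ≡⟨ cong (_xor f (lookup Q) v) (proj₁ kernels v) ⟩
        f (lookup Q) v                             ≡⟨ x⊕y≡0⇒y≡x (proj₂ kernels v) ⟩
        lookup Q v                                 ∎
      g-join≗P : g (lookup (join (P , Q))) ≗ lookup P
      g-join≗P v = trans (cong₂ _xor_ (lookup∘tabulate (lookup P ⊕ lookup Q) v) (f-join≗Q v)) ([x⊕y]⊕y≡x (lookup P v) (lookup Q v))

    splitting : BijectionBetween (λ _ → true) (λ z → inKernel? f (proj₁ z) ∧ inKernel? g (proj₂ z))
    splitting = record { to = split ; from = join ; to-∈ = λ S _ → split-∈ S ; from-∈ = λ _ _ → refl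
                       ; from∘to = λ S _ → join∘split S ; to∘from = split∘join }

  permute : (Fin n → Fin n) → Subset n → Subset n
  permute π S = tabulate (λ v → lookup S (π v))

  permute-inverse : ∀ {π π⁻¹ : Fin n → Fin n} → (∀ x → π (π⁻¹ x) ≡ x) → ∀ S → permute π⁻¹ (permute π S) ≡ S
  permute-inverse {π} {π⁻¹} π∘π⁻¹ S = tabulate-≗ S (λ v → trans (lookup∘tabulate _ (π⁻¹ v)) (cong (lookup S) (π∘π⁻¹ v)))

  ∣ker∣-conjugate : ∀ {f g} → Congruent f → Congruent g → (π π⁻¹ : Fin n → Fin n) →
    (∀ x → π (π⁻¹ x) ≡ x) → (∀ x → π⁻¹ (π x) ≡ x) → (∀ s v → g (λ x → s (π x)) v ≡ f s (π v)) → ∣ker g ∣ ≡ ∣ker f ∣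
  ∣ker∣-conjugate {f} {g} f-cong g-cong π π⁻¹ π∘π⁻¹ π⁻¹∘π intertwines =
    count-bijection (subsetEnumeration n) (subsetEnumeration n) (record
      { to      = permute π⁻¹
      ; from    = permute π
      ; to-∈    = λ T e → dec-true (isZero? _) (f-kills T (does≡true⇒ (isZero? _) e))
      ; from-∈  = λ S e → dec-true (isZero? _) (g-kills S (does≡true⇒ (isZero? _) e))
      ; from∘to = λ T _ → permute-inverse π⁻¹∘π T
      ; to∘from = λ S _ → permute-inverse π∘π⁻¹ S
      })
    where
    g-kills : ∀ S → IsZero (f (lookup S)) → IsZero (g (lookup (permute π S)))
    g-kills S z v = trans (g-cong (lookup∘tabulate _) v) (trans (intertwines (lookup S) v) (z (π v)))

    f-kills : ∀ T → IsZero (g (lookup T)) → IsZero (f (lookup (permute π⁻¹ T)))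
    f-kills T z w = begin
      f (lookup (permute π⁻¹ T)) w                   ≡⟨ f-cong (lookup∘tabulate _) w ⟩
      f (λ x → lookup T (π⁻¹ x)) w                   ≡⟨ cong (f _) (sym (π∘π⁻¹ w)) ⟩
      f (λ x → lookup T (π⁻¹ x)) (π (π⁻¹ w))         ≡⟨ sym (intertwines _ (π⁻¹ w)) ⟩
      g (λ x → lookup T (π⁻¹ (π x))) (π⁻¹ w)         ≡⟨ g-cong (λ x → cong (lookup T) (π⁻¹∘π x)) (π⁻¹ w) ⟩
      g (lookup T) (π⁻¹ w)                           ≡⟨ z (π⁻¹ w) ⟩
      false                                          ∎
      where open ≡-Reasoning

  total-not : isOdd n ≡ true → ∀ s → total (λ v → not (s v)) ≡ not (total s)
  total-not n-odd s = trans (⨁-xor (allFin n) (const true) s) (cong (_xor total s) total-1)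
    where
    total-1 : total (const true) ≡ true
    total-1 = trans (sym (isOdd-count (allFin n) (const true))) (trans (cong isOdd (count-true-allFin n)) n-odd)

  -- Complementation preserves ker (J ⊕ id ⊕ f) and flips the weight parity; on even weight J vanishes.
  ∣ker-J⊕id⊕∣≡2*∣ker-id⊕∣ : isOdd n ≡ true → ∀ {f} → Congruent f → Additive f →
    (∀ b → IsZero (f (const b))) → (∀ s → total (f s) ≡ false) →
    ∣ker (λ s → const (total s) ⊕ s ⊕ f s) ∣ ≡ 2 * ∣ker (λ s → s ⊕ f s) ∣
  ∣ker-J⊕id⊕∣≡2*∣ker-id⊕∣ n-odd {f} f-cong f-additive f-const f-total = begin
    ∣ker h ∣                                            ≡⟨ count-split (allSubsets n) (inKernel? h) weight ⟩
    count odd-part (allSubsets n) +ℕ count even-part (allSubsets n)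
                                                        ≡⟨ cong (_+ℕ count even-part (allSubsets n)) odd≡even ⟩
    count even-part (allSubsets n) +ℕ count even-part (allSubsets n)
                                                        ≡⟨ cong₂ _+ℕ_ even≡ (trans even≡ (sym (ℕ.+-identityʳ _))) ⟩
    2 * ∣ker g ∣                                         ∎
    where
    open ≡-Reasoning
    h g : 𝔹ⁿ → 𝔹ⁿ
    h s = const (total s) ⊕ s ⊕ f s
    g s = s ⊕ f s

    weight odd-part even-part : Subset n → Bool
    weight S = total (lookup S)
    odd-part S = inKernel? h S ∧ weight S
    even-part S = inKernel? h S ∧ not (weight S)

    h-∁ : ∀ S → h (lookup (∁ S)) ≗ h (lookup S)
    h-∁ S v = begin
      (total (lookup (∁ S)) xor lookup (∁ S) v) xor f (lookup (∁ S)) v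
        ≡⟨ cong₂ (λ t x → (t xor x) xor f (lookup (∁ S)) v) (trans (⨁-cong (allFin n) (lookup-∁ S)) (total-not n-odd s)) (lookup-∁ S v) ⟩
      (not (total s) xor not (s v)) xor f (lookup (∁ S)) v
        ≡⟨ cong₂ _xor_ (xor-annihilates-not (total s) (s v)) (trans (f-cong (lookup-∁ S) v) (f-additive (const true) s v)) ⟩
      (total s xor s v) xor (f (const true) v xor f s v)
        ≡⟨ cong (λ x → (total s xor s v) xor (x xor f s v)) (f-const true v) ⟩
      (total s xor s v) xor f s v ∎
      where s = lookup S

    odd≡even : count odd-part (allSubsets n) ≡ count even-part (allSubsets n)
    odd≡even = trans (sym (count-permute (subsetEnumeration n) ∁ ∁ ∁-involutive ∁-involutive odd-part))
                     (count-cong (allSubsets n) (λ S → cong₂ _∧_ (isZero-≗ (h-∁ S)) (weight-∁ S)))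
      where
      weight-∁ : ∀ S → weight (∁ S) ≡ not (weight S)
      weight-∁ S = trans (⨁-cong (allFin n) (lookup-∁ S)) (total-not n-odd (lookup S))

    even≡ : count even-part (allSubsets n) ≡ ∣ker g ∣
    even≡ = count-cong (allSubsets n) even-part≡
      where
      even-part≡ : ∀ S → even-part S ≡ inKernel? g S
      even-part≡ S with weight S in w
      ... | false = ∧-identityʳ (inKernel? g S)
      ... | true  = trans (∧-zeroʳ _) (sym (dec-false (isZero? (g (lookup S))) λ z → contradiction (begin
        true                   ≡⟨ sym w ⟩
        total (lookup S)       ≡⟨ ⨁-cong (allFin n) (λ v → sym (x⊕y≡0⇒y≡x (z v))) ⟩
        total (f (lookup S))   ≡⟨ f-total (lookup S) ⟩
        false                  ∎) λ ()))

  constant⇒⊥⊎⊤ : ∀ {S : Subset n} b → lookup S ≗ const b → S ≡ ⊥ ⊎ S ≡ ⊤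
  constant⇒⊥⊎⊤ false S≗0 = inj₁ (lookup-injective (λ v → trans (S≗0 v) (sym (lookup-replicate v false))))
  constant⇒⊥⊎⊤ true  S≗1 = inj₂ (lookup-injective (λ v → trans (S≗1 v) (sym (lookup-replicate v true))))

  ∣ker∣≡2 : Fin n → ∀ {f} → Congruent f → (∀ b → IsZero (f (const b))) →
    (∀ s → IsZero (f s) → Σ Bool (λ b → s ≗ const b)) → ∣ker f ∣ ≡ 2
  ∣ker∣≡2 v₀ {f} f-cong f-const kernel-constant =
    count≡2 (subsetEnumeration n) (inKernel? f) ⊥≢⊤ (constant-in-kernel false) (constant-in-kernel true) only-constants
    where
    ⊥≢⊤ : ⊥ ≢ ⊤
    ⊥≢⊤ ⊥≡⊤ = contradiction (trans (sym (lookup-replicate v₀ false)) (trans (cong (λ S → lookup S v₀) ⊥≡⊤) (lookup-replicate v₀ true))) λ ()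
    constant-in-kernel : ∀ b → inKernel? f (replicate n b) ≡ true
    constant-in-kernel b = dec-true (isZero? _) (λ v → trans (f-cong (λ u → lookup-replicate u b) v) (f-const b v))
    only-constants : ∀ S → inKernel? f S ≡ true → S ≡ ⊥ ⊎ S ≡ ⊤
    only-constants S e = let b , S≗b = kernel-constant (lookup S) (does≡true⇒ (isZero? _) e) in constant⇒⊥⊎⊤ b S≗b

module PaleyAdjacency {q : ℕ} (F : FiniteField q) (m : ℕ) (q≡1+4m : q ≡ suc ((m +ℕ m) +ℕ (m +ℕ m))) where
  open import Data.Bool using (Bool; true; false; not; _∧_; _xor_)
  open import Data.Bool.Properties
    using (∧-distribˡ-xor; ∧-distribʳ-xor; ∧-identityʳ; ∧-zeroʳ; ∧-comm; ∧-assoc; not-involutive; xor-identityʳ)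
  open import Data.Empty using (⊥-elim)
  open import Data.Fin using (Fin)
  open import Data.Fin.Properties using (_≟_)
  open import Data.Fin.Subset using (Subset; ∁; ⊥; ⊤)
  open import Algebra.Properties.CommutativeSemigroup using (x∙yz≈y∙xz)
  open import Data.Nat using (_^_) renaming (_*_ to _*ℕ_)
  import Data.Nat.Properties as ℕ
  open import Data.Product using (Σ; _,_; proj₁; proj₂)
  open import Data.Sum using (_⊎_; inj₁; inj₂)
  open import Data.Vec using (lookup)
  open import Data.Vec.Properties using (lookup⇒[]=)
  open import Function.Bundles using (_⇔_; mk⇔; Equivalence)
  open import Relation.Binary.Definitions using (tri<; tri≈; tri>)
  open import Relation.Binary.PropositionalEquality
  open import Relation.Nullary.Decidable using (dec-true; dec-false; does-⇔)
  open Paley F using (degIn; CoEven; coEven?)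
  open FieldArithmetic F
  open QuadraticResidues F
  open Cyclotomy F m q≡1+4m
  open BinaryKernels q
  open Counting
  open Parity

  A Ā : 𝔹ⁿ → 𝔹ⁿ
  A s v = ⨁ 𝔽 (λ u → s u ∧ isResidue (v - u))
  Ā s v = ⨁ 𝔽 (λ u → s u ∧ isNonresidue (v - u))

  A-cong : Congruent A
  A-cong s≗t v = ⨁-cong 𝔽 (λ u → cong (_∧ isResidue (v - u)) (s≗t u))

  Ā-cong : Congruent Ā
  Ā-cong s≗t v = ⨁-cong 𝔽 (λ u → cong (_∧ isNonresidue (v - u)) (s≗t u))

  A-additive : Additive A
  A-additive s t v = trans (⨁-cong 𝔽 (λ u → ∧-distribʳ-xor (isResidue (v - u)) (s u) (t u))) (⨁-xor 𝔽 _ _)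

  isResidue-sym : ∀ u v → isResidue (v - u) ≡ isResidue (u - v)
  isResidue-sym u v = trans (sym (isResidue-neg (v - u))) (cong isResidue (-‿anti-homo‿- v u))

  degree-even : ∀ v → ⨁ 𝔽 (λ u → isResidue (v - u)) ≡ false
  degree-even v = begin
    ⨁ 𝔽 (λ u → isResidue (v - u))              ≡⟨ sym (isOdd-count 𝔽 _) ⟩
    isOdd (count (λ u → isResidue (v - u)) 𝔽)  ≡⟨ cong isOdd (count-reflect v isResidue) ⟩
    isOdd (count isResidue 𝔽)                  ≡⟨ cong isOdd count-residue ⟩
    isOdd (m +ℕ m)                             ≡⟨ isOdd-double m ⟩
    false                                      ∎
    where open ≡-Reasoning

  A-const : ∀ b → IsZero (A (const b))
  A-const b v = trans (⨁-∧ˡ 𝔽 b _) (trans (cong (b ∧_) (degree-even v)) (∧-zeroʳ b))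

  A-total : ∀ s → total (A s) ≡ false
  A-total s = begin
    ⨁ 𝔽 (λ v → ⨁ 𝔽 (λ u → s u ∧ isResidue (v - u)))   ≡⟨ ⨁-swap 𝔽 𝔽 _ ⟩
    ⨁ 𝔽 (λ u → ⨁ 𝔽 (λ v → s u ∧ isResidue (v - u)))   ≡⟨ ⨁-cong 𝔽 (λ u → ⨁-∧ˡ 𝔽 (s u) _) ⟩
    ⨁ 𝔽 (λ u → s u ∧ ⨁ 𝔽 (λ v → isResidue (v - u)))   ≡⟨ ⨁-cong 𝔽 (λ u → cong (s u ∧_) (trans (⨁-cong 𝔽 (λ v → isResidue-sym u v)) (degree-even u))) ⟩
    ⨁ 𝔽 (λ u → s u ∧ false)                           ≡⟨ ⨁-cong 𝔽 (λ u → ∧-zeroʳ (s u)) ⟩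
    ⨁ 𝔽 (λ _ → false)                                 ≡⟨ ⨁-false 𝔽 ⟩
    false                                             ∎
    where open ≡-Reasoning

  Ā≗J⊕id⊕A : ∀ s → Ā s ≗ const (total s) ⊕ s ⊕ A s
  Ā≗J⊕id⊕A s v = begin
    ⨁ 𝔽 (λ u → s u ∧ isNonresidue (v - u))
      ≡⟨ ⨁-cong 𝔽 (λ u → trans (cong (s u ∧_) (isNonresidue≡¬zero⊕residue (v - u))) (distrib (s u) _ _)) ⟩
    ⨁ 𝔽 (λ u → (s u xor (s u ∧ isZero (v - u))) xor (s u ∧ isResidue (v - u)))
      ≡⟨ trans (⨁-xor 𝔽 _ _) (cong (_xor A s v) (⨁-xor 𝔽 _ _)) ⟩
    (total s xor ⨁ 𝔽 (λ u → s u ∧ isZero (v - u))) xor A s v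
      ≡⟨ cong (λ x → (total s xor x) xor A s v) (⨁-point (finEnumeration q) v _ off-diagonal) ⟩
    (total s xor (s v ∧ isZero (v - v))) xor A s v
      ≡⟨ cong (λ x → (total s xor x) xor A s v) (trans (cong (s v ∧_) (dec-true (v - v ≟ 0#) (-‿inverseʳ v))) (∧-identityʳ (s v))) ⟩
    (total s xor s v) xor A s v
      ∎
    where
    open ≡-Reasoning
    distrib : ∀ a z r → a ∧ ((true xor z) xor r) ≡ (a xor (a ∧ z)) xor (a ∧ r)
    distrib a z r = trans (∧-distribˡ-xor a (true xor z) r) (cong (_xor (a ∧ r)) (trans (∧-distribˡ-xor a true z) (cong (_xor (a ∧ z)) (∧-identityʳ a))))
    off-diagonal : ∀ u → v ≢ u → s u ∧ isZero (v - u) ≡ false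
    off-diagonal u v≢u = trans (cong (s u ∧_) (dec-false (v - u ≟ 0#) (λ v-u≡0 → v≢u (x-y≡0⇒x≡y v u v-u≡0)))) (∧-zeroʳ (s u))

  count-common-neighbours : ∀ u v → count (λ w → isResidue (w - u) ∧ isResidue (v - w)) 𝔽 ≡ commonNeighbours (v - u)
  count-common-neighbours u v = trans (sym (count-reflect v _)) (count-cong 𝔽 (λ t →
    trans (cong₂ (λ a b → isResidue a ∧ isResidue b) (x-y-z≡x-z-y v t u) (x-[x-y]≡y v t)) (∧-comm _ (isResidue t))))

  A∘A : ∀ s v → A (A s) v ≡ ⨁ 𝔽 (λ u → s u ∧ isOdd (commonNeighbours (v - u)))
  A∘A s v = begin
    ⨁ 𝔽 (λ w → ⨁ 𝔽 (λ u → s u ∧ isResidue (w - u)) ∧ isResidue (v - w))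
      ≡⟨ ⨁-cong 𝔽 (λ w → trans (∧-comm _ (isResidue (v - w))) (sym (⨁-∧ˡ 𝔽 (isResidue (v - w)) _))) ⟩
    ⨁ 𝔽 (λ w → ⨁ 𝔽 (λ u → isResidue (v - w) ∧ (s u ∧ isResidue (w - u))))
      ≡⟨ ⨁-swap 𝔽 𝔽 _ ⟩
    ⨁ 𝔽 (λ u → ⨁ 𝔽 (λ w → isResidue (v - w) ∧ (s u ∧ isResidue (w - u))))
      ≡⟨ ⨁-cong 𝔽 (λ u → trans (⨁-cong 𝔽 (λ w → rearrange (isResidue (v - w)) (s u) (isResidue (w - u)))) (⨁-∧ˡ 𝔽 (s u) _)) ⟩
    ⨁ 𝔽 (λ u → s u ∧ ⨁ 𝔽 (λ w → isResidue (w - u) ∧ isResidue (v - w)))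
      ≡⟨ ⨁-cong 𝔽 (λ u → cong (s u ∧_) (trans (sym (isOdd-count 𝔽 _)) (cong isOdd (count-common-neighbours u v)))) ⟩
    ⨁ 𝔽 (λ u → s u ∧ isOdd (commonNeighbours (v - u)))
      ∎
    where
    open ≡-Reasoning
    rearrange : ∀ a b c → a ∧ (b ∧ c) ≡ b ∧ (c ∧ a)
    rearrange a b c = trans (∧-comm a (b ∧ c)) (∧-assoc b c a)

  private
    isOdd-commonNeighbours-0 : ∀ {d} → d ≡ 0# → isOdd (commonNeighbours d) ≡ false
    isOdd-commonNeighbours-0 d≡0 = trans (cong (λ x → isOdd (commonNeighbours x)) d≡0) (trans (cong isOdd commonNeighbours-0) (isOdd-double m))

    isOdd-commonNeighbours-residue : ∀ {d} → Residue d → isOdd (commonNeighbours d) ≡ not (isOdd m)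
    isOdd-commonNeighbours-residue {d} Rd = trans (sym (not-involutive (isOdd (commonNeighbours d)))) (cong (λ n → not (isOdd n)) (1+commonNeighbours-residue≡m Rd))

    isOdd-commonNeighbours-nonresidue : ∀ {d} → Nonresidue d → isOdd (commonNeighbours d) ≡ isOdd m
    isOdd-commonNeighbours-nonresidue Nd = cong isOdd (commonNeighbours-nonresidue≡m Nd)

  isOdd-commonNeighbours≡isResidue : isOdd m ≡ false → ∀ d → isOdd (commonNeighbours d) ≡ isResidue d
  isOdd-commonNeighbours≡isResidue m-even d with residuosity d
  ... | inj₁ d≡0        = trans (isOdd-commonNeighbours-0 d≡0) (sym (dec-false (residue? d) (λ (d≢0 , _) → d≢0 d≡0)))
  ... | inj₂ (inj₁ Rd) = trans (isOdd-commonNeighbours-residue Rd) (trans (cong not m-even) (sym (dec-true (residue? d) Rd)))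
  ... | inj₂ (inj₂ Nd) = trans (isOdd-commonNeighbours-nonresidue Nd) (trans m-even (sym (dec-false (residue? d) (λ (_ , □d) → proj₂ Nd □d))))

  isOdd-commonNeighbours≡isNonresidue : isOdd m ≡ true → ∀ d → isOdd (commonNeighbours d) ≡ isNonresidue d
  isOdd-commonNeighbours≡isNonresidue m-odd d with residuosity d
  ... | inj₁ d≡0        = trans (isOdd-commonNeighbours-0 d≡0) (sym (dec-false (nonresidue? d) (λ (d≢0 , _) → d≢0 d≡0)))
  ... | inj₂ (inj₁ Rd) = trans (isOdd-commonNeighbours-residue Rd) (trans (cong not m-odd) (sym (dec-false (nonresidue? d) (λ (_ , ¬□d) → ¬□d (proj₂ Rd)))))
  ... | inj₂ (inj₂ Nd) = trans (isOdd-commonNeighbours-nonresidue Nd) (trans m-odd (sym (dec-true (nonresidue? d) Nd)))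

  A∘A≗A : isOdd m ≡ false → ∀ s → A (A s) ≗ A s
  A∘A≗A m-even s v = trans (A∘A s v) (⨁-cong 𝔽 (λ u → cong (s u ∧_) (isOdd-commonNeighbours≡isResidue m-even (v - u))))

  A∘A≗Ā : isOdd m ≡ true → ∀ s → A (A s) ≗ Ā s
  A∘A≗Ā m-odd s v = trans (A∘A s v) (⨁-cong 𝔽 (λ u → cong (s u ∧_) (isOdd-commonNeighbours≡isNonresidue m-odd (v - u))))

  A∘scale≗Ā : ∀ {ν} → Nonresidue ν → ∀ s v → A (λ x → s (ν * x)) v ≡ Ā s (ν * v)
  A∘scale≗Ā {ν} Nν@(ν≢0 , _) s v = trans (⨁-cong 𝔽 pointwise)
    (⨁-permute (finEnumeration q) (ν *_) (ν ⁻¹ *_) (λ x → x*[x⁻¹*y]≡y x ν≢0) (λ x → x⁻¹*[x*y]≡y x ν≢0) (λ u → s u ∧ isNonresidue (ν * v - u)))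
    where
    pointwise : ∀ x → s (ν * x) ∧ isResidue (v - x) ≡ s (ν * x) ∧ isNonresidue (ν * v - ν * x)
    pointwise x = cong (s (ν * x) ∧_) (sym (trans (cong isNonresidue (sym (x[y-z]≈xy-xz ν v x))) (isNonresidue-*-nonresidue (v - x) Nν)))

  isOdd-degIn : ∀ S v → isOdd (degIn S v) ≡ A (lookup S) v
  isOdd-degIn S v = trans (cong isOdd (length-filter _ 𝔽)) (trans (isOdd-count 𝔽 _) (⨁-cong 𝔽 (λ u → cong (_∧ isResidue (v - u)) (does-∈ u S))))

  isOdd-degIn-∁ : ∀ S v → isOdd (degIn (∁ S) v) ≡ A (lookup S) v
  isOdd-degIn-∁ S v = begin
    isOdd (degIn (∁ S) v)                            ≡⟨ isOdd-degIn (∁ S) v ⟩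
    A (lookup (∁ S)) v                               ≡⟨ A-cong (lookup-∁ S) v ⟩
    A (const true ⊕ lookup S) v                      ≡⟨ A-additive (const true) (lookup S) v ⟩
    A (const true) v xor A (lookup S) v              ≡⟨ cong (_xor A (lookup S) v) (A-const true v) ⟩
    A (lookup S) v                                   ∎
    where open ≡-Reasoning

  coEven⇔A-kernel : ∀ S → CoEven S ⇔ IsZero (A (lookup S))
  coEven⇔A-kernel S = mk⇔ to from
    where
    to : CoEven S → IsZero (A (lookup S))
    to (even-S , even-∁S) v with lookup S v in v∈?S
    ... | true  = trans (sym (isOdd-degIn S v)) (n%2≡0⇒even (degIn S v) (even-S v (lookup⇒[]= v S v∈?S)))
    ... | false = trans (sym (isOdd-degIn-∁ S v))
                        (n%2≡0⇒even (degIn (∁ S) v) (even-∁S v (lookup⇒[]= v (∁ S) (trans (lookup-∁ S v) (cong not v∈?S)))))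
    from : IsZero (A (lookup S)) → CoEven S
    from z = (λ v _ → even⇒n%2≡0 (degIn S v) (trans (isOdd-degIn S v) (z v)))
           , (λ v _ → even⇒n%2≡0 (degIn (∁ S) v) (trans (isOdd-degIn-∁ S v) (z v)))

  numCoEven≡∣ker-A∣ : numCoEven F ≡ ∣ker A ∣
  numCoEven≡∣ker-A∣ = trans (length-filter coEven? (allSubsets q))
    (count-cong (allSubsets q) (λ S → does-⇔ (coEven⇔A-kernel S) (coEven? S) (isZero? _)))

  ∣ker-A∣≡∣ker-Ā∣ : ∣ker A ∣ ≡ ∣ker Ā ∣
  ∣ker-A∣≡∣ker-Ā∣ = ∣ker∣-conjugate Ā-cong A-cong (ν *_) (ν ⁻¹ *_) (λ x → x*[x⁻¹*y]≡y x ν≢0) (λ x → x⁻¹*[x*y]≡y x ν≢0)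
                      (A∘scale≗Ā Nν)
    where
    ν = proj₁ nonresidue-exists
    Nν = proj₂ nonresidue-exists
    ν≢0 = proj₁ Nν

  numCoEven≡2^[2m+1] : isOdd m ≡ false → numCoEven F ≡ 2 ^ suc (m +ℕ m)
  numCoEven≡2^[2m+1] m-even = trans numCoEven≡∣ker-A∣ (m*m≡n*n⇒m≡n ∣ker A ∣ _ (begin
    ∣ker A ∣ *ℕ ∣ker A ∣                  ≡⟨ cong (∣ker A ∣ *ℕ_) (trans ∣ker-A∣≡∣ker-Ā∣ (trans (∣ker∣-cong Ā≗J⊕id⊕A)
                                                (∣ker-J⊕id⊕∣≡2*∣ker-id⊕∣ isOdd-q A-cong A-additive A-const A-total))) ⟩
    ∣ker A ∣ *ℕ (2 *ℕ ∣ker id⊕A ∣)         ≡⟨ x∙yz≈y∙xz ℕ.*-commutativeSemigroup ∣ker A ∣ 2 ∣ker id⊕A ∣ ⟩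
    2 *ℕ (∣ker A ∣ *ℕ ∣ker id⊕A ∣)         ≡⟨ cong (2 *ℕ_) (∣ker∣*∣ker-id⊕∣≡2^n A-cong A-additive (A∘A≗A m-even)) ⟩
    2 ^ suc q                             ≡⟨ cong (λ n → 2 ^ suc n) q≡1+4m ⟩
    2 ^ suc (suc ((m +ℕ m) +ℕ (m +ℕ m)))    ≡⟨ cong (λ n → 2 ^ suc n) (sym (ℕ.+-suc (m +ℕ m) (m +ℕ m))) ⟩
    2 ^ (suc (m +ℕ m) +ℕ suc (m +ℕ m))      ≡⟨ ℕ.^-distribˡ-+-* 2 (suc (m +ℕ m)) (suc (m +ℕ m)) ⟩
    2 ^ suc (m +ℕ m) *ℕ 2 ^ suc (m +ℕ m)     ∎))
    where
    open ≡-Reasoning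
    id⊕A : 𝔹ⁿ → 𝔹ⁿ
    id⊕A s = s ⊕ A s
    m*m≡n*n⇒m≡n : ∀ a b → a *ℕ a ≡ b *ℕ b → a ≡ b
    m*m≡n*n⇒m≡n a b a²≡b² with ℕ.<-cmp a b
    ... | tri< a<b _ _ = ⊥-elim (ℕ.<-irrefl a²≡b² (ℕ.*-mono-< a<b a<b))
    ... | tri≈ _ a≡b _ = a≡b
    ... | tri> _ _ b<a = ⊥-elim (ℕ.<-irrefl (sym a²≡b²) (ℕ.*-mono-< b<a b<a))

  A-kernel-constant : isOdd m ≡ true → ∀ s → IsZero (A s) → Σ Bool (λ b → s ≗ const b)
  A-kernel-constant m-odd s As≡0 = total s , λ v → x⊕y≡0⇒y≡x (begin
    total s xor s v                   ≡⟨ sym (trans (cong ((total s xor s v) xor_) (As≡0 v)) (xor-identityʳ _)) ⟩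
    (total s xor s v) xor A s v       ≡⟨ sym (Ā≗J⊕id⊕A s v) ⟩
    Ā s v                             ≡⟨ sym (A∘A≗Ā m-odd s v) ⟩
    A (A s) v                         ≡⟨ A-cong As≡0 v ⟩
    A (const false) v                 ≡⟨ A-const false v ⟩
    false                             ∎)
    where open ≡-Reasoning

  numCoEven≡2 : isOdd m ≡ true → numCoEven F ≡ 2
  numCoEven≡2 m-odd = trans numCoEven≡∣ker-A∣ (∣ker∣≡2 0# A-cong A-const (A-kernel-constant m-odd))

  coEven⇒⊥⊎⊤ : isOdd m ≡ true → ∀ S → CoEven S → S ≡ ⊥ ⊎ S ≡ ⊤
  coEven⇒⊥⊎⊤ m-odd S coEven =
    let b , S≗b = A-kernel-constant m-odd (lookup S) (Equivalence.to (coEven⇔A-kernel S) coEven) in constant⇒⊥⊎⊤ b S≗b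

module PaleyCoEven {q : ℕ} (F : FiniteField q) (q%4≡1 : q % 4 ≡ 1) where
  open import Data.Bool using (true; false)
  open import Data.Fin.Subset using (Subset; ⊥; ⊤)
  open import Data.Nat using (_*_; _/_; _^_)
  open import Data.Nat.DivMod using (m≡m%n+[m/n]*n; m*n/n≡m)
  open import Data.Nat.Tactic.RingSolver using (solve-∀)
  open import Data.Sum using (_⊎_)
  open import Relation.Binary.PropositionalEquality
  open import Relation.Nullary.Negation using (contradiction)
  open Counting using (𝟙)
  open Parity using (isOdd; [1+4m]%8≡1+4[isOdd-m])

  m : ℕ
  m = q / 4

  q≡1+4m : q ≡ suc ((m +ℕ m) +ℕ (m +ℕ m))
  q≡1+4m = trans (m≡m%n+[m/n]*n q 4) (cong₂ _+ℕ_ q%4≡1 (quadruple m))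
    where
    quadruple : ∀ n → n * 4 ≡ (n +ℕ n) +ℕ (n +ℕ n)
    quadruple = solve-∀

  open PaleyAdjacency F m q≡1+4m

  q%8≡1+4[isOdd-m] : q % 8 ≡ 1 +ℕ 4 * 𝟙 (isOdd m)
  q%8≡1+4[isOdd-m] = trans (cong (_% 8) q≡1+4m) ([1+4m]%8≡1+4[isOdd-m] m)

  q%8≡1⇒m-even : q % 8 ≡ 1 → isOdd m ≡ false
  q%8≡1⇒m-even q%8≡1 with isOdd m | q%8≡1+4[isOdd-m]
  ... | false | _     = refl
  ... | true  | q%8≡5 = contradiction (trans (sym q%8≡5) q%8≡1) λ ()

  q%8≡5⇒m-odd : q % 8 ≡ 5 → isOdd m ≡ true
  q%8≡5⇒m-odd q%8≡5 with isOdd m | q%8≡1+4[isOdd-m]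
  ... | true  | _     = refl
  ... | false | q%8≡1 = contradiction (trans (sym q%8≡1) q%8≡5) λ ()

  [q+1]/2≡1+2m : (q +ℕ 1) / 2 ≡ suc (m +ℕ m)
  [q+1]/2≡1+2m = trans (cong (λ n → (n +ℕ 1) / 2) q≡1+4m) (trans (cong (_/ 2) (double (m +ℕ m))) (m*n/n≡m (suc (m +ℕ m)) 2))
    where
    double : ∀ n → suc (n +ℕ n) +ℕ 1 ≡ suc n * 2
    double = solve-∀

  numCoEven-1mod8 : q % 8 ≡ 1 → numCoEven F ≡ 2 ^ ((q +ℕ 1) / 2)
  numCoEven-1mod8 q%8≡1 = trans (numCoEven≡2^[2m+1] (q%8≡1⇒m-even q%8≡1)) (cong (2 ^_) (sym [q+1]/2≡1+2m))

  numCoEven-5mod8 : q % 8 ≡ 5 → numCoEven F ≡ 2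
  numCoEven-5mod8 q%8≡5 = numCoEven≡2 (q%8≡5⇒m-odd q%8≡5)

  coEven-trivial-5mod8 : q % 8 ≡ 5 → (S : Subset q) → Paley.CoEven F S → S ≡ ⊥ ⊎ S ≡ ⊤
  coEven-trivial-5mod8 q%8≡5 = coEven⇒⊥⊎⊤ (q%8≡5⇒m-odd q%8≡5)

open import Data.Nat using (_^_; _/_; _+_)
open import Data.Fin.Subset using (Subset; ⊥; ⊤)
open import Data.Product using (_×_; _,_)
open import Data.Sum using (_⊎_)

theorem1p3 : (q : ℕ) → (F : FiniteField q) → IsPrimePower q → q % 4 ≡ 1 →
    (q % 8 ≡ 1 → numCoEven F ≡ 2 ^ ((q + 1) / 2)) ×
    (q % 8 ≡ 5 → numCoEven F ≡ 2) ×
    (q % 8 ≡ 5 → (S : Subset q) → Paley.CoEven F S → S ≡ ⊥ ⊎ S ≡ ⊤)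
theorem1p3 q F _ q%4≡1 = numCoEven-1mod8 , numCoEven-5mod8 , coEven-trivial-5mod8
  where open PaleyCoEven F q%4≡1
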